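{- Let $i(G)$ denote the total number of independent sets (of all sizes, including the empty set) in a graph $G$, and let $\mathcal{G}(n,2)$ be the family of simple graphs on $n$ vertices with minimum degree exactly $2$. For $n\ge 4$ and every $G\in\mathcal{G}(n,2)$ we have $i(G)\le i(K_{2,n-2})$, where $K_{2,n-2}$ is the complete bipartite graph with parts of sizes $2$ and $n-2$. For $n=4$ and for $n\ge 6$, equality holds if and only if $G=K_{2,n-2}$.
   Context: All graphs are finite, simple and loopless. An independent set is a set of vertices spanning no edges. -}

module Defs where

open import Data.Nat using (ℕ; zero; suc; _<ᵇ_)
open import Data.Bool using (Bool; true; false; _xor_)
open import Data.Bool.Properties using (_≟_; xor-same)
open import Data.Fin using (Fin; toℕ)
open import Data.Fin.Properties using (all?)
open import Data.Vec using (Vec; []; _∷_; lookup)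
open import Data.List using (List; [_]; map; _++_; filter; length; allFin)
open import Data.Product using (Σ; _×_)
open import Function.Definitions using (Bijective)
open import Relation.Nullary using (Dec; yes; no)
open import Relation.Nullary.Decidable using (_→-dec_)
open import Relation.Binary.PropositionalEquality using (_≡_; refl)

record Graph (n : ℕ) : Set where
  field
    adj    : Fin n → Fin n → Bool
    sym    : ∀ u v → adj u v ≡ adj v u
    irrefl : ∀ v → adj v v ≡ false
open Graph public

Subset : ℕ → Set
Subset n = Vec Bool n

allSubsets : (n : ℕ) → List (Subset n)
allSubsets zero    = [ [] ]
allSubsets (suc n) = map (true ∷_) (allSubsets n) ++ map (false ∷_) (allSubsets n)

Independent : ∀ {n} → Graph n → Subset n → Set
Independent G S = ∀ u v → lookup S u ≡ true → lookup S v ≡ true → adj G u v ≡ false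

independent? : ∀ {n} (G : Graph n) (S : Subset n) → Dec (Independent G S)
independent? G S = all? λ u → all? λ v →
  (lookup S u ≟ true) →-dec ((lookup S v ≟ true) →-dec (adj G u v ≟ false))

i : ∀ {n} → Graph n → ℕ
i {n} G = length (filter (independent? G) (allSubsets n))

degree : ∀ {n} → Graph n → Fin n → ℕ
degree {n} G v = length (filter (λ u → adj G v u ≟ true) (allFin n))

-- minimum degree exactly k (n ≥ 1 is implied by the existential)
MinDegree : ∀ {n} → Graph n → ℕ → Set
MinDegree {n} G k = (∀ v → k Data.Nat.≤ degree G v) × Σ (Fin n) (λ v → degree G v ≡ k)

_≅_ : ∀ {n} → Graph n → Graph n → Set
_≅_ {n} G H = Σ (Fin n → Fin n) λ f →
  Bijective _≡_ _≡_ f × (∀ u v → adj G u v ≡ adj H (f u) (f v))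

-- K_{2,n-2} on Fin n: part {0,1} and part {2,…,n-1}; edges exactly between parts.
small : ∀ {n} → Fin n → Bool
small u = toℕ u <ᵇ 2

private
  xor-comm : ∀ x y → x xor y ≡ y xor x
  xor-comm true true = refl
  xor-comm true false = refl
  xor-comm false true = refl
  xor-comm false false = refl

K2 : (n : ℕ) → Graph n
K2 n = record
  { adj    = λ u v → small u xor small v
  ; sym    = λ u v → xor-comm (small u) (small v)
  ; irrefl = λ v → xor-same (small v)
  }

module Submission where

-- We count the independent sets inside a vertex set X, I G X = i(G[X]), and prove by
-- strong induction on k = |X| ≥ 3 that if G[X] has minimum degree ≥ 2 then
-- I G X ≤ maxI k (maxI 3 = 4 and maxI k = 2^(k-2) + 3), strictly unless k ∈ {3, 5}
-- or G[X] is K_{2,k-2} (the type Outcome).  The tools are the vertex recursion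
-- i(G[Y]) = i(G[Y - z]) + i(G[Y - N[z]]) (I-split), its analogue for adding an edge
-- (I-addEdge) and the trivial bound i(G[Y]) ≤ 2^|Y|.  If every vertex has three
-- neighbours in X we split at any vertex (all-degree-three).  Otherwise some v has
-- exactly two neighbours a, b (module Pendant); according to whether a ~ b, whether
-- a and b have further neighbours, and whether R = X - {v, a, b} spans an edge, we
-- reduce to the induction hypothesis on X - v or X - a (possibly after adding an
-- edge) together with the counting lemmas NeighbourhoodBound and CBound about R.

open import Defs renaming (sym to adj-sym)
open import Data.Nat using (ℕ; zero; suc; _+_; _*_; _∸_; _^_; _≤_; _<_; _≤?_; _<?_; z≤n; s≤s; >-nonZero)
open import Data.Nat.Properties
open import Data.Nat.Induction using (<-rec)
open import Data.Nat.Tactic.RingSolver using (solve-∀)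
open import Data.Bool using (Bool; true; false; not; _∧_; _∨_; _xor_; if_then_else_)
open import Data.Bool.Properties using (∨-comm; ∨-zeroʳ; ∨-identityʳ) renaming (_≟_ to _≟ᵇ_)
open import Data.Fin using (Fin; zero; suc)
open import Data.Fin.Properties using (all?; any?) renaming (_≟_ to _≟ᶠ_)
import Data.Fin.Permutation as Perm
import Data.Fin.Permutation.Components as PC
open import Data.Vec using ([]; _∷_; lookup; updateAt)
open import Data.Vec.Properties using (lookup∘updateAt; lookup∘updateAt′)
open import Data.List using (List; []; _∷_; map; _++_; filter; length; tabulate)
open import Data.List.Properties using (filter-++; length-++)
open import Data.Product using (∃-syntax; _×_; _,_; proj₁; proj₂; swap)
open import Data.Sum using (_⊎_; inj₁; inj₂)
import Data.Sum as Sum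
open import Function using (_∘_; _∘′_; id)
open import Function.Bundles using (_⇔_; mk⇔; Bijection)
open import Function.Definitions using (Bijective)
open import Function.Properties.Inverse using (↔⇒⤖)
open import Relation.Nullary using (Dec; yes; no; does; ¬_; contradiction)
open import Relation.Nullary.Decidable using (_×-dec_; _→-dec_; _⊎-dec_; ¬?; map′; from-yes; dec-true; dec-false)
open import Relation.Unary using (Decidable; _∩_)
open import Relation.Unary.Properties using (_∩?_; ∁?)
open import Relation.Binary.PropositionalEquality
open import Algebra.Properties.CommutativeSemigroup +-commutativeSemigroup using (interchange)

pin : ∀ {n} {P : Subset (suc n) → Set} (b : Bool) → Decidable P → Decidable (λ S → P (b ∷ S))
pin b P? S = P? (b ∷ S)

count : ∀ {n} {P : Subset n → Set} → Decidable P → ℕ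
count {zero}  P? = if does (P? []) then 1 else 0
count {suc n} P? = count (pin true P?) + count (pin false P?)

count-mono : ∀ {n} {P Q : Subset n → Set} (P? : Decidable P) (Q? : Decidable Q) →
  (∀ {S} → P S → Q S) → count P? ≤ count Q?
count-mono {zero} P? Q? P⇒Q with P? [] | Q? []
... | yes p | yes _ = ≤-refl
... | yes p | no ¬q = contradiction (P⇒Q p) ¬q
... | no _  | _     = z≤n
count-mono {suc n} P? Q? P⇒Q =
  +-mono-≤ (count-mono (pin true P?) (pin true Q?) P⇒Q) (count-mono (pin false P?) (pin false Q?) P⇒Q)

count-cong : ∀ {n} {P Q : Subset n → Set} (P? : Decidable P) (Q? : Decidable Q) →
  (∀ {S} → P S → Q S) → (∀ {S} → Q S → P S) → count P? ≡ count Q?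
count-cong P? Q? P⇒Q Q⇒P = ≤-antisym (count-mono P? Q? P⇒Q) (count-mono Q? P? Q⇒P)

count-none : ∀ {n} {P : Subset n → Set} (P? : Decidable P) → (∀ S → ¬ P S) → count P? ≡ 0
count-none {zero} P? ¬P with P? []
... | yes p = contradiction p (¬P [])
... | no _  = refl
count-none {suc n} P? ¬P =
  cong₂ _+_ (count-none (pin true P?) (¬P ∘ (true ∷_))) (count-none (pin false P?) (¬P ∘ (false ∷_)))

count-partition : ∀ {n} {P A : Subset n → Set} (P? : Decidable P) (A? : Decidable A) →
  count P? ≡ count (P? ∩? A?) + count (P? ∩? ∁? A?)
count-partition {zero} P? A? with P? [] | A? []
... | yes _ | yes _ = refl
... | yes _ | no _  = refl
... | no _  | yes _ = refl
... | no _  | no _  = refl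
count-partition {suc n} P? A? = begin
  count (pin true P?) + count (pin false P?)
    ≡⟨ cong₂ _+_ (count-partition (pin true P?) (pin true A?)) (count-partition (pin false P?) (pin false A?)) ⟩
  (count (pin true (P? ∩? A?)) + count (pin true (P? ∩? ∁? A?)))
    + (count (pin false (P? ∩? A?)) + count (pin false (P? ∩? ∁? A?)))
    ≡⟨ interchange (count (pin true (P? ∩? A?))) (count (pin true (P? ∩? ∁? A?)))
                   (count (pin false (P? ∩? A?))) (count (pin false (P? ∩? ∁? A?))) ⟩
  count (P? ∩? A?) + count (P? ∩? ∁? A?) ∎
  where open ≡-Reasoning

toggle : ∀ {n} → Fin n → Subset n → Subset n
toggle z S = updateAt S z not

-- Toggling a fixed vertex is a bijection on subsets, so it preserves counts.
count-toggle : ∀ {n} (z : Fin n) {P : Subset n → Set} (P? : Decidable P) →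
  count P? ≡ count (P? ∘ toggle z)
count-toggle zero    P? = +-comm (count (pin true P?)) (count (pin false P?))
count-toggle (suc z) P? = cong₂ _+_ (count-toggle z (pin true P?)) (count-toggle z (pin false P?))

count-allSubsets : ∀ n {P : Subset n → Set} (P? : Decidable P) →
  length (filter P? (allSubsets n)) ≡ count P?
count-allSubsets zero P? with P? []
... | yes _ = refl
... | no _  = refl
count-allSubsets (suc n) P? = begin
  length (filter P? (map (true ∷_) (allSubsets n) ++ map (false ∷_) (allSubsets n)))
    ≡⟨ cong length (filter-++ P? (map (true ∷_) (allSubsets n)) _) ⟩
  length (filter P? (map (true ∷_) (allSubsets n)) ++ filter P? (map (false ∷_) (allSubsets n)))
    ≡⟨ length-++ (filter P? (map (true ∷_) (allSubsets n))) ⟩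
  length (filter P? (map (true ∷_) (allSubsets n))) + length (filter P? (map (false ∷_) (allSubsets n)))
    ≡⟨ cong₂ _+_ (length-filter-map (true ∷_) (allSubsets n)) (length-filter-map (false ∷_) (allSubsets n)) ⟩
  length (filter (pin true P?) (allSubsets n)) + length (filter (pin false P?) (allSubsets n))
    ≡⟨ cong₂ _+_ (count-allSubsets n (pin true P?)) (count-allSubsets n (pin false P?)) ⟩
  count P? ∎
  where
  open ≡-Reasoning
  length-filter-map : (f : Subset n → Subset (suc n)) (xs : List (Subset n)) →
    length (filter P? (map f xs)) ≡ length (filter (P? ∘ f) xs)
  length-filter-map f [] = refl
  length-filter-map f (x ∷ xs) with does (P? (f x))
  ... | true  = cong suc (length-filter-map f xs)
  ... | false = length-filter-map f xs

VSet : ℕ → Set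
VSet n = Fin n → Bool

-- Membership is a record, so that the set is recoverable from a membership proof.
infix 4 _∈_ _∉_ _⊆_
record _∈_ {n} (u : Fin n) (Y : VSet n) : Set where
  constructor mem
  field is-member : Y u ≡ true
open _∈_ public

_∉_ : ∀ {n} → Fin n → VSet n → Set
u ∉ Y = ¬ (u ∈ Y)

_∈?_ : ∀ {n} (u : Fin n) (Y : VSet n) → Dec (u ∈ Y)
u ∈? Y = map′ mem is-member (Y u ≟ᵇ true)

_⊆_ : ∀ {n} → VSet n → VSet n → Set
Y ⊆ Z = ∀ {u} → u ∈ Y → u ∈ Z

full : ∀ {n} → VSet n
full _ = true

infixl 6 _-_
_-_ : ∀ {n} → VSet n → Fin n → VSet n
(Y - z) u = if does (u ≟ᶠ z) then false else Y u

∈-remove⁺ : ∀ {n} {Y : VSet n} {z u} → u ∈ Y → u ≢ z → u ∈ Y - z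
∈-remove⁺ {Y = Y} {z} {u} (mem u∈Y) u≢z = mem kept
  where
  kept : (Y - z) u ≡ true
  kept with u ≟ᶠ z
  ... | yes u≡z = contradiction u≡z u≢z
  ... | no _    = u∈Y

∈-remove⁻ : ∀ {n} {Y : VSet n} {z u} → u ∈ Y - z → u ∈ Y × u ≢ z
∈-remove⁻ {z = z} {u} (mem u∈Y-z) with u ≟ᶠ z
... | yes _   = contradiction u∈Y-z λ ()
... | no u≢z  = mem u∈Y-z , u≢z

remove-⊆ : ∀ {n} {Y : VSet n} {z} → Y - z ⊆ Y
remove-⊆ u∈Y-z = proj₁ (∈-remove⁻ u∈Y-z)

infixl 6 _-N[_]_
_-N[_]_ : ∀ {n} → VSet n → Graph n → Fin n → VSet n
(Y -N[ G ] z) u = if adj G z u then false else (Y - z) u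

∈-removeN⁺ : ∀ {n} {G : Graph n} {Y : VSet n} {z u} →
  u ∈ Y → u ≢ z → adj G z u ≡ false → u ∈ Y -N[ G ] z
∈-removeN⁺ {G = G} {Y} {z} {u} u∈Y u≢z z≁u = mem kept
  where
  kept : (Y -N[ G ] z) u ≡ true
  kept rewrite z≁u = is-member (∈-remove⁺ u∈Y u≢z)

∈-removeN⁻ : ∀ {n} {G : Graph n} {Y : VSet n} {z u} →
  u ∈ Y -N[ G ] z → u ∈ Y × u ≢ z × adj G z u ≡ false
∈-removeN⁻ {G = G} {Y} {z} {u} (mem h) with adj G z u
... | true  = contradiction h λ ()
... | false = let (u∈Y , u≢z) = ∈-remove⁻ (mem h) in u∈Y , u≢z , refl

removeN-⊆-remove : ∀ {n} {G : Graph n} {Y : VSet n} {z} → Y -N[ G ] z ⊆ Y - z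
removeN-⊆-remove {G = G} {Y} {z} {u} (mem h) with adj G z u
... | true  = contradiction h λ ()
... | false = mem h

size : ∀ {n} → VSet n → ℕ
size {zero}  Y = 0
size {suc n} Y = (if Y zero then 1 else 0) + size (Y ∘ suc)

private
  tail-⊆ : ∀ {n} {Y Z : VSet (suc n)} → Y ⊆ Z → Y ∘ suc ⊆ Z ∘ suc
  tail-⊆ Y⊆Z (mem h) = mem (is-member (Y⊆Z (mem h)))

size-mono : ∀ {n} {Y Z : VSet n} → Y ⊆ Z → size Y ≤ size Z
size-mono {zero}  Y⊆Z = z≤n
size-mono {suc n} {Y} {Z} Y⊆Z with Y zero in eY | Z zero in eZ
... | true  | true  = s≤s (size-mono (tail-⊆ Y⊆Z))
... | true  | false = contradiction (trans (sym (is-member (Y⊆Z (mem eY)))) eZ) λ ()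
... | false | true  = m≤n⇒m≤1+n (size-mono (tail-⊆ Y⊆Z))
... | false | false = size-mono (tail-⊆ Y⊆Z)

size-cong : ∀ {n} {Y Z : VSet n} → Y ⊆ Z → Z ⊆ Y → size Y ≡ size Z
size-cong Y⊆Z Z⊆Y = ≤-antisym (size-mono Y⊆Z) (size-mono Z⊆Y)

size-remove : ∀ {n} (Y : VSet n) {z} → z ∈ Y → size Y ≡ suc (size (Y - z))
size-remove {suc n} Y {zero} (mem z∈Y) rewrite z∈Y = refl
size-remove {suc n} Y {suc z} (mem z∈Y) with Y zero
... | true  = cong suc (size-remove (Y ∘ suc) (mem z∈Y))
... | false = size-remove (Y ∘ suc) (mem z∈Y)

size-full : ∀ n → size (full {n}) ≡ n
size-full zero    = refl
size-full (suc n) = cong suc (size-full n)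

size-empty : ∀ {n} (Y : VSet n) → (∀ u → u ∉ Y) → size Y ≡ 0
size-empty {zero}  Y _ = refl
size-empty {suc n} Y empty with Y zero in e
... | true  = contradiction (mem e) (empty zero)
... | false = size-empty (Y ∘ suc) λ u (mem h) → empty (suc u) (mem h)

nonempty-member : ∀ {n} (Y : VSet n) → 0 < size Y → ∃[ z ] z ∈ Y
nonempty-member {suc n} Y pos with Y zero in e
... | true  = zero , mem e
... | false = let (z , mem z∈Y) = nonempty-member (Y ∘ suc) pos in suc z , mem z∈Y

Within : ∀ {n} → VSet n → Subset n → Set
Within Y S = ∀ u → lookup S u ≡ true → u ∈ Y

within? : ∀ {n} (Y : VSet n) → Decidable (Within Y)
within? Y S = all? λ u → (lookup S u ≟ᵇ true) →-dec (u ∈? Y)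

count-within : ∀ {n} (Y : VSet n) → count (within? Y) ≡ 2 ^ size Y
count-within {zero} Y with within? Y []
... | yes _  = refl
... | no ¬w = contradiction (λ ()) ¬w
count-within {suc n} Y = by-first-entry (Y zero) refl
  where
  open ≡-Reasoning
  Y′ = Y ∘ suc
  extend-in : ∀ {S} → zero ∈ Y → Within Y′ S → Within Y (true ∷ S)
  extend-in 0∈Y w zero    _  = 0∈Y
  extend-in 0∈Y w (suc u) Su = mem (is-member (w u Su))
  extend-out : ∀ {S} → Within Y′ S → Within Y (false ∷ S)
  extend-out w (suc u) Su = mem (is-member (w u Su))
  drop-first : ∀ {b S} → Within Y (b ∷ S) → Within Y′ S
  drop-first w u Su = mem (is-member (w (suc u) Su))
  by-first-entry : (b : Bool) → Y zero ≡ b → count (within? Y) ≡ 2 ^ ((if b then 1 else 0) + size Y′)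
  by-first-entry true e = begin
    count (pin true (within? Y)) + count (pin false (within? Y))
      ≡⟨ cong₂ _+_ (count-cong (pin true (within? Y)) (within? Y′) drop-first (extend-in (mem e)))
                   (count-cong (pin false (within? Y)) (within? Y′) drop-first extend-out) ⟩
    count (within? Y′) + count (within? Y′)
      ≡⟨ cong₂ _+_ (count-within Y′) (trans (count-within Y′) (sym (+-identityʳ _))) ⟩
    2 ^ size Y′ + (2 ^ size Y′ + 0) ∎
  by-first-entry false e = begin
    count (pin true (within? Y)) + count (pin false (within? Y))
      ≡⟨ cong₂ _+_ (count-none (pin true (within? Y)) (λ S w → contradiction (trans (sym (is-member (w zero refl))) e) λ ()))
                   (count-cong (pin false (within? Y)) (within? Y′) drop-first extend-out) ⟩
    count (within? Y′)
      ≡⟨ count-within Y′ ⟩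
    2 ^ size Y′ ∎

Stable : ∀ {n} → Graph n → VSet n → Set
Stable G Y = ∀ {u v} → u ∈ Y → v ∈ Y → adj G u v ≡ false

-- I G Y : the number of independent sets of G inside Y, i.e. i(G[Y]).
I : ∀ {n} → Graph n → VSet n → ℕ
I G Y = count (within? Y ∩? independent? G)

I-≤-2^ : ∀ {n} (G : Graph n) (Y : VSet n) → I G Y ≤ 2 ^ size Y
I-≤-2^ G Y = subst (I G Y ≤_) (count-within Y) (count-mono (within? Y ∩? independent? G) (within? Y) proj₁)

I-stable : ∀ {n} (G : Graph n) (Y : VSet n) → Stable G Y → I G Y ≡ 2 ^ size Y
I-stable G Y stable = trans (count-cong (within? Y ∩? independent? G) (within? Y) proj₁
  (λ w → w , λ u v Su Sv → stable (w u Su) (w v Sv))) (count-within Y)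

I-mono : ∀ {n} (G : Graph n) {Y Z : VSet n} → Y ⊆ Z → I G Y ≤ I G Z
I-mono G {Y} {Z} Y⊆Z = count-mono (within? Y ∩? independent? G) (within? Z ∩? independent? G)
  λ (w , ind) → (λ u Su → Y⊆Z (w u Su)) , ind

I-cong : ∀ {n} (G : Graph n) {Y Z : VSet n} → Y ⊆ Z → Z ⊆ Y → I G Y ≡ I G Z
I-cong G {Y} {Z} Y⊆Z Z⊆Y = ≤-antisym (I-mono G {Y} {Z} Y⊆Z) (I-mono G {Z} {Y} Z⊆Y)

I-agree : ∀ {n} (G H : Graph n) (Y : VSet n) →
  (∀ {u v} → u ∈ Y → v ∈ Y → adj G u v ≡ adj H u v) → I G Y ≡ I H Y
I-agree G H Y same = count-cong (within? Y ∩? independent? G) (within? Y ∩? independent? H)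
  (λ (w , ind) → w , λ u v Su Sv → trans (sym (same (w u Su) (w v Sv))) (ind u v Su Sv))
  (λ (w , ind) → w , λ u v Su Sv → trans (same (w u Su) (w v Sv)) (ind u v Su Sv))

I-empty : ∀ {n} (G : Graph n) (Y : VSet n) → (∀ u → u ∉ Y) → I G Y ≡ 1
I-empty G Y empty =
  trans (I-stable G Y (λ {u} u∈Y → contradiction u∈Y (empty u))) (cong (2 ^_) (size-empty Y empty))

∈-toggle⁺ : ∀ {n} {z u : Fin n} {S} → u ≢ z → lookup S u ≡ true → lookup (toggle z S) u ≡ true
∈-toggle⁺ {z = z} {u} {S} u≢z Su = trans (lookup∘updateAt′ u z u≢z S) Su

∈-toggle⁻ : ∀ {n} {z u : Fin n} {S} → lookup (toggle z S) u ≡ true → u ≡ z ⊎ lookup S u ≡ true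
∈-toggle⁻ {z = z} {u} {S} h with u ≟ᶠ z
... | yes u≡z = inj₁ u≡z
... | no u≢z  = inj₂ (trans (sym (lookup∘updateAt′ u z u≢z S)) h)

contains? : ∀ {n} (z : Fin n) → Decidable (λ S → lookup S z ≡ true)
contains? z S = lookup S z ≟ᵇ true

I-avoiding : ∀ {n} (G : Graph n) (Y : VSet n) z →
  count ((within? Y ∩? independent? G) ∩? ∁? (contains? z)) ≡ I G (Y - z)
I-avoiding G Y z = count-cong ((within? Y ∩? independent? G) ∩? ∁? (contains? z)) (within? (Y - z) ∩? independent? G)
  (λ ((w , ind) , z∉S) → (λ u Su → ∈-remove⁺ (w u Su) λ { refl → z∉S Su }) , ind)
  (λ (w , ind) → ((λ u Su → remove-⊆ (w u Su)) , ind) , λ Sz → proj₂ (∈-remove⁻ (w z Sz)) refl)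

-- Toggling z maps the independent sets inside Y containing z (z ∈ Y) onto the
-- independent sets inside Y - N[z]: removing z leaves a set avoiding N[z], and
-- adding z to such a set keeps it independent.
I-containing : ∀ {n} (G : Graph n) (Y : VSet n) {z} → z ∈ Y →
  count (((within? Y ∩? independent? G) ∩? contains? z) ∘ toggle z) ≡ I G (Y -N[ G ] z)
I-containing G Y {z} z∈Y = count-cong (((within? Y ∩? independent? G) ∩? contains? z) ∘ toggle z)
  (within? (Y -N[ G ] z) ∩? independent? G) (λ {S} → remove-z {S}) (λ {S} → add-z {S})
  where
  remove-z : ∀ {S} → ((Within Y ∩ Independent G) ∩ (λ T → lookup T z ≡ true)) (toggle z S) →
             (Within (Y -N[ G ] z) ∩ Independent G) S
  remove-z {S} ((w , ind) , z∈T) = within , λ u v Su Sv → ind u v (in-T Su) (in-T Sv)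
    where
    z∉S : lookup S z ≡ false
    z∉S with lookup S z | trans (sym (lookup∘updateAt z S)) z∈T
    ... | false | _ = refl
    ≢z : ∀ {u} → lookup S u ≡ true → u ≢ z
    ≢z Su refl = contradiction (trans (sym Su) z∉S) λ ()
    in-T : ∀ {u} → lookup S u ≡ true → lookup (toggle z S) u ≡ true
    in-T Su = ∈-toggle⁺ {S = S} (≢z Su) Su
    within : Within (Y -N[ G ] z) S
    within u Su = ∈-removeN⁺ {G = G} (w u (in-T Su)) (≢z Su) (ind z u z∈T (in-T Su))
  add-z : ∀ {S} → (Within (Y -N[ G ] z) ∩ Independent G) S →
          ((Within Y ∩ Independent G) ∩ (λ T → lookup T z ≡ true)) (toggle z S)
  add-z {S} (w , ind) = (within , ind′) , z∈T
    where
    z∉S : lookup S z ≡ false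
    z∉S with lookup S z in e
    ... | true  = contradiction refl (proj₁ (proj₂ (∈-removeN⁻ {G = G} (w z e))))
    ... | false = refl
    z∈T : lookup (toggle z S) z ≡ true
    z∈T = trans (lookup∘updateAt z S) (cong not z∉S)
    within : Within Y (toggle z S)
    within u Tu with ∈-toggle⁻ {S = S} Tu
    ... | inj₁ refl = z∈Y
    ... | inj₂ Su   = proj₁ (∈-removeN⁻ {G = G} (w u Su))
    ind′ : Independent G (toggle z S)
    ind′ u v Tu Tv with ∈-toggle⁻ {S = S} Tu | ∈-toggle⁻ {S = S} Tv
    ... | inj₁ refl | inj₁ refl = irrefl G z
    ... | inj₁ refl | inj₂ Sv   = proj₂ (proj₂ (∈-removeN⁻ {G = G} (w v Sv)))
    ... | inj₂ Su   | inj₁ refl = trans (adj-sym G u z) (proj₂ (proj₂ (∈-removeN⁻ {G = G} (w u Su))))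
    ... | inj₂ Su   | inj₂ Sv   = ind u v Su Sv

-- The fundamental recursion i(G[Y]) = i(G[Y - z]) + i(G[Y - N[z]]): an independent
-- set inside Y either avoids z, or contains z and hence avoids every neighbour of z.
I-split : ∀ {n} (G : Graph n) (Y : VSet n) {z} → z ∈ Y → I G Y ≡ I G (Y - z) + I G (Y -N[ G ] z)
I-split G Y {z} z∈Y = begin
  I G Y                                                        ≡⟨ count-partition indep? (contains? z) ⟩
  count (indep? ∩? contains? z) + count (indep? ∩? ∁? (contains? z)) ≡⟨ +-comm (count (indep? ∩? contains? z)) _ ⟩
  count (indep? ∩? ∁? (contains? z)) + count (indep? ∩? contains? z) ≡⟨ cong₂ _+_ (I-avoiding G Y z)
                                                                        (trans (count-toggle z (indep? ∩? contains? z)) (I-containing G Y z∈Y)) ⟩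
  I G (Y - z) + I G (Y -N[ G ] z) ∎
  where
  open ≡-Reasoning
  indep? = within? Y ∩? independent? G

addEdge : ∀ {n} (G : Graph n) (x y : Fin n) → x ≢ y → Graph n
addEdge G x y x≢y = record
  { adj    = λ u v → adj G u v ∨ joins u v
  ; sym    = λ u v → cong₂ _∨_ (adj-sym G u v) (∨-comm (joins₁ u v) (joins₁ v u))
  ; irrefl = loopless
  }
  where
  joins₁ joins : _ → _ → Bool
  joins₁ u v = does (u ≟ᶠ x) ∧ does (v ≟ᶠ y)
  joins u v  = joins₁ u v ∨ joins₁ v u
  loopless : ∀ v → adj G v v ∨ joins v v ≡ false
  loopless v rewrite irrefl G v with v ≟ᶠ x | v ≟ᶠ y
  ... | yes refl | yes refl = contradiction refl x≢y
  ... | yes _    | no _     = refl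
  ... | no _     | _        = refl

module _ {n} (G : Graph n) {x y : Fin n} (x≢y : x ≢ y) where

  addEdge-keeps : ∀ {u v} → adj G u v ≡ true → adj (addEdge G x y x≢y) u v ≡ true
  addEdge-keeps u~v rewrite u~v = refl

  addEdge-adds : adj (addEdge G x y x≢y) x y ≡ true
  addEdge-adds with x ≟ᶠ x | y ≟ᶠ y
  ... | yes _ | yes _ = ∨-zeroʳ (adj G x y)
  ... | no x≢x | _    = contradiction refl x≢x
  ... | _    | no y≢y = contradiction refl y≢y

  private
    not-joined : ∀ {s t} → ¬ (s ≡ x × t ≡ y) → does (s ≟ᶠ x) ∧ does (t ≟ᶠ y) ≡ false
    not-joined {s} {t} ¬st with s ≟ᶠ x | t ≟ᶠ y
    ... | yes s≡x | yes t≡y = contradiction (s≡x , t≡y) ¬st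
    ... | yes _   | no _    = refl
    ... | no _    | _       = refl

  addEdge-non-edge : ∀ {u v} → adj (addEdge G x y x≢y) u v ≡ false → adj G u v ≡ false
  addEdge-non-edge {u} {v} u≁v with adj G u v
  ... | true  = contradiction u≁v λ ()
  ... | false = refl

  addEdge-elsewhere : ∀ {u v} → ¬ (u ≡ x × v ≡ y) → ¬ (u ≡ y × v ≡ x) →
    adj (addEdge G x y x≢y) u v ≡ adj G u v
  addEdge-elsewhere {u} {v} ¬xy ¬yx rewrite not-joined ¬xy | not-joined (¬yx ∘ swap) =
    ∨-identityʳ (adj G u v)

  I-addEdge-away : ∀ {Z : VSet n} → (∀ {u} → u ∈ Z → u ≢ x) → I (addEdge G x y x≢y) Z ≡ I G Z
  I-addEdge-away ≢x = I-agree (addEdge G x y x≢y) G _ λ u∈Z v∈Z →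
    addEdge-elsewhere (λ (u≡x , _) → ≢x u∈Z u≡x) (λ (_ , v≡x) → ≢x v∈Z v≡x)

  -- In G + xy the closed neighbourhood of x additionally contains y.
  addEdge-removeN : ∀ (Y : VSet n) → I (addEdge G x y x≢y) (Y -N[ addEdge G x y x≢y ] x) ≡ I G ((Y -N[ G ] x) - y)
  addEdge-removeN Y = trans (I-addEdge-away (λ h → proj₁ (proj₂ (∈-removeN⁻ {G = addEdge G x y x≢y} h))))
                            (I-cong G N⁺x⊆ ⊆N⁺x)
    where
    N⁺x⊆ : Y -N[ addEdge G x y x≢y ] x ⊆ (Y -N[ G ] x) - y
    N⁺x⊆ h with ∈-removeN⁻ {G = addEdge G x y x≢y} h
    ... | u∈Y , u≢x , x≁⁺u =
      ∈-remove⁺ (∈-removeN⁺ {G = G} u∈Y u≢x (addEdge-non-edge x≁⁺u))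
        λ { refl → contradiction (trans (sym addEdge-adds) x≁⁺u) λ () }
    ⊆N⁺x : (Y -N[ G ] x) - y ⊆ Y -N[ addEdge G x y x≢y ] x
    ⊆N⁺x h with ∈-remove⁻ h
    ... | u∈Y-Nx , u≢y with ∈-removeN⁻ {G = G} u∈Y-Nx
    ... | u∈Y , u≢x , x≁u = ∈-removeN⁺ {G = addEdge G x y x≢y} u∈Y u≢x
      (trans (addEdge-elsewhere (λ (_ , u≡y) → u≢y u≡y) (λ (x≡y , _) → x≢y x≡y)) x≁u)

  -- Adding the edge xy (x, y ∈ Y non-adjacent) loses exactly the independent sets
  -- containing both x and y:  i(G[Y]) = i((G + xy)[Y]) + i(G[Y - N[x] - N[y]]).
  I-addEdge : ∀ (Y : VSet n) → x ∈ Y → y ∈ Y → adj G x y ≡ false →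
    I G Y ≡ I (addEdge G x y x≢y) Y + I G ((Y -N[ G ] x) -N[ G ] y)
  I-addEdge Y x∈Y y∈Y x≁y = begin
    I G Y                                                          ≡⟨ I-split G Y x∈Y ⟩
    I G (Y - x) + I G (Y -N[ G ] x)                                ≡⟨ cong (I G (Y - x) +_) (I-split G (Y -N[ G ] x) y∈Y-Nx) ⟩
    I G (Y - x) + (I G ((Y -N[ G ] x) - y) + I G ((Y -N[ G ] x) -N[ G ] y))
                                                                   ≡⟨ +-assoc (I G (Y - x)) _ _ ⟨
    (I G (Y - x) + I G ((Y -N[ G ] x) - y)) + I G ((Y -N[ G ] x) -N[ G ] y)
                                                                   ≡⟨ cong (_+ I G ((Y -N[ G ] x) -N[ G ] y)) (sym I-G⁺) ⟩
    I G⁺ Y + I G ((Y -N[ G ] x) -N[ G ] y) ∎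
    where
    open ≡-Reasoning
    G⁺ = addEdge G x y x≢y
    y∈Y-Nx : y ∈ Y -N[ G ] x
    y∈Y-Nx = ∈-removeN⁺ {G = G} y∈Y (λ y≡x → x≢y (sym y≡x)) x≁y
    I-G⁺ : I G⁺ Y ≡ I G (Y - x) + I G ((Y -N[ G ] x) - y)
    I-G⁺ = begin
      I G⁺ Y                                   ≡⟨ I-split G⁺ Y x∈Y ⟩
      I G⁺ (Y - x) + I G⁺ (Y -N[ G⁺ ] x)       ≡⟨ cong₂ _+_ (I-addEdge-away (λ h → proj₂ (∈-remove⁻ h))) (addEdge-removeN Y) ⟩
      I G (Y - x) + I G ((Y -N[ G ] x) - y) ∎

i≡I-full : ∀ {n} (G : Graph n) → i G ≡ I G full
i≡I-full {n} G = trans (count-allSubsets n (independent? G))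
  (count-cong (independent? G) (within? full ∩? independent? G) (λ ind → (λ _ _ → mem refl) , ind) proj₂)

N : ∀ {n} → Graph n → Fin n → VSet n
N G v = adj G v

degree≡size-N : ∀ {n} (G : Graph n) (v : Fin n) → degree G v ≡ size (N G v)
degree≡size-N {n} G v = trans (length-filter-tabulate (λ u → adj G v u ≟ᵇ true) id)
  (size-cong {Y = λ u → does (adj G v u ≟ᵇ true)} {N G v}
    (λ (mem h) → mem (trans (sym (does-≟-true _)) h)) (λ (mem h) → mem (trans (does-≟-true _) h)))
  where
  does-≟-true : ∀ b → does (b ≟ᵇ true) ≡ b
  does-≟-true true  = refl
  does-≟-true false = refl
  length-filter-tabulate : ∀ {A : Set} {P : A → Set} (P? : Decidable P) {m} (f : Fin m → A) →
    length (filter P? (tabulate f)) ≡ size (λ u → does (P? (f u)))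
  length-filter-tabulate P? {zero}  f = refl
  length-filter-tabulate P? {suc m} f with does (P? (f zero))
  ... | true  = cong suc (length-filter-tabulate P? (f ∘ suc))
  ... | false = length-filter-tabulate P? (f ∘ suc)

two-members : ∀ {n} (Y : VSet n) → 2 ≤ size Y → ∃[ p ] ∃[ q ] p ≢ q × p ∈ Y × q ∈ Y
two-members Y 2≤∣Y∣ with nonempty-member Y (≤-trans (s≤s z≤n) 2≤∣Y∣)
... | p , p∈Y with nonempty-member (Y - p) (≤-pred (subst (2 ≤_) (size-remove Y p∈Y) 2≤∣Y∣))
... | q , q∈Y-p = p , q , (λ p≡q → proj₂ (∈-remove⁻ q∈Y-p) (sym p≡q)) , p∈Y , remove-⊆ q∈Y-p

adjacent⇒≢ : ∀ {n} (G : Graph n) {x y} → adj G x y ≡ true → x ≢ y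
adjacent⇒≢ G {x} x~y refl = contradiction (trans (sym x~y) (irrefl G x)) λ ()

neighbour≢non-neighbour : ∀ {n} (G : Graph n) {z w u} → adj G z w ≡ true → adj G z u ≡ false → u ≢ w
neighbour≢non-neighbour G z~w z≁u refl = contradiction (trans (sym z~w) z≁u) λ ()

record TwoNeighbours {n} (G : Graph n) (X : VSet n) (x : Fin n) : Set where
  constructor twoNeighbours
  field
    {p q} : Fin n
    p≢q   : p ≢ q
    p∈X   : p ∈ X
    q∈X   : q ∈ X
    x~p   : adj G x p ≡ true
    x~q   : adj G x q ≡ true

MinDeg2 : ∀ {n} → Graph n → VSet n → Set
MinDeg2 G X = ∀ {x} → x ∈ X → TwoNeighbours G X x

two-neighbours-kept : ∀ {n} {G : Graph n} {X X′ : VSet n} {x} → TwoNeighbours G X x →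
  (∀ {w} → w ∈ X → adj G x w ≡ true → w ∈ X′) → TwoNeighbours G X′ x
two-neighbours-kept (twoNeighbours p≢q p∈X q∈X x~p x~q) kept =
  twoNeighbours p≢q (kept p∈X x~p) (kept q∈X x~q) x~p x~q

two-neighbours-super : ∀ {n} {G H : Graph n} {X : VSet n} {x} →
  (∀ {w} → adj G x w ≡ true → adj H x w ≡ true) → TwoNeighbours G X x → TwoNeighbours H X x
two-neighbours-super G⊆H (twoNeighbours p≢q p∈X q∈X x~p x~q) = twoNeighbours p≢q p∈X q∈X (G⊆H x~p) (G⊆H x~q)

another-neighbour : ∀ {n} {G : Graph n} {X : VSet n} {x} → TwoNeighbours G X x →
  (z : Fin n) → ∃[ w ] w ∈ X × adj G x w ≡ true × w ≢ z
another-neighbour (twoNeighbours {p} {q} p≢q p∈X q∈X x~p x~q) z with p ≟ᶠ z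
... | yes refl = q , q∈X , x~q , λ q≡p → p≢q (sym q≡p)
... | no p≢z   = p , p∈X , x~p , p≢z

size-remove₂ : ∀ {n} (Y : VSet n) {p q} → p ∈ Y → q ∈ Y → p ≢ q → size Y ≡ 2 + size (Y - p - q)
size-remove₂ Y {p} p∈Y q∈Y p≢q =
  trans (size-remove Y p∈Y) (cong suc (size-remove (Y - p) (∈-remove⁺ q∈Y λ q≡p → p≢q (sym q≡p))))

size-remove₃ : ∀ {n} (Y : VSet n) {p q r} → p ∈ Y → q ∈ Y → r ∈ Y → p ≢ q → p ≢ r → q ≢ r →
  size Y ≡ 3 + size (Y - p - q - r)
size-remove₃ Y {p} {q} p∈Y q∈Y r∈Y p≢q p≢r q≢r = trans (size-remove₂ Y p∈Y q∈Y p≢q)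
  (cong (2 +_) (size-remove (Y - p - q)
    (∈-remove⁺ (∈-remove⁺ r∈Y λ r≡p → p≢r (sym r≡p)) λ r≡q → q≢r (sym r≡q))))

three≤size : ∀ {n} {G : Graph n} {X : VSet n} {x} → x ∈ X → TwoNeighbours G X x → 3 ≤ size X
three≤size {G = G} {X} x∈X (twoNeighbours p≢q p∈X q∈X x~p x~q) =
  subst (3 ≤_) (sym (size-remove₃ X x∈X p∈X q∈X (adjacent⇒≢ G x~p) (adjacent⇒≢ G x~q) p≢q)) (m≤m+n 3 _)

I-≤-2^-⊇ : ∀ {n} (G : Graph n) {Y Z : VSet n} → Y ⊆ Z → I G Y ≤ 2 ^ size Z
I-≤-2^-⊇ G {Y} Y⊆Z = ≤-trans (I-≤-2^ G Y) (^-monoʳ-≤ 2 (size-mono Y⊆Z))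

I-≤-pow : ∀ {n} (G : Graph n) {Y Z : VSet n} j {s} → Y ⊆ Z → size Z ≡ j + s → I G Y ≤ 2 ^ j * 2 ^ s
I-≤-pow G j {s} Y⊆Z ∣Z∣ =
  subst (I G _ ≤_) (trans (cong (2 ^_) ∣Z∣) (^-distribˡ-+-* 2 j s)) (I-≤-2^-⊇ G Y⊆Z)

sum-≤ : ∀ a b Z {x y} → x ≤ a * Z → y ≤ b * Z → x + y ≤ (a + b) * Z
sum-≤ a b Z {x} {y} x≤ y≤ = subst (x + y ≤_) (sym (*-distribʳ-+ Z a b)) (+-mono-≤ x≤ y≤)

sum-< : ∀ a b c Z {x y} → 0 < Z → a + b < c → x ≤ a * Z → y ≤ b * Z → x + y < c * Z
sum-< a b c Z {x} {y} 0<Z a+b<c x≤ y≤ = begin-strict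
  x + y           ≤⟨ sum-≤ a b Z x≤ y≤ ⟩
  (a + b) * Z     <⟨ +-monoˡ-< ((a + b) * Z) 0<Z ⟩
  suc (a + b) * Z ≤⟨ *-monoˡ-≤ Z a+b<c ⟩
  c * Z ∎
  where open ≤-Reasoning

I-split-≤ : ∀ {n} (G : Graph n) (Y : VSet n) {z} a b Z → z ∈ Y →
  I G (Y - z) ≤ a * Z → I G (Y -N[ G ] z) ≤ b * Z → I G Y ≤ (a + b) * Z
I-split-≤ G Y a b Z z∈Y ≤₁ ≤₂ = subst (_≤ (a + b) * Z) (sym (I-split G Y z∈Y)) (sum-≤ a b Z ≤₁ ≤₂)

I-split-< : ∀ {n} (G : Graph n) (Y : VSet n) {z} a b c Z → z ∈ Y → 0 < Z → a + b < c →
  I G (Y - z) ≤ a * Z → I G (Y -N[ G ] z) ≤ b * Z → I G Y < c * Z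
I-split-< G Y a b c Z z∈Y 0<Z a+b<c ≤₁ ≤₂ =
  subst (_< c * Z) (sym (I-split G Y z∈Y)) (sum-< a b c Z 0<Z a+b<c ≤₁ ≤₂)

-- A set spanning an edge xy has fewer than 2^|R| independent subsets:
-- the independent sets containing x avoid y.
I-edge-< : ∀ {n} (G : Graph n) (R : VSet n) {x y} → x ∈ R → y ∈ R → adj G x y ≡ true →
  I G R < 2 ^ size R
I-edge-< G R {x} {y} x∈R y∈R x~y = begin-strict
  I G R         <⟨ I-split-< G R 2 1 4 (2 ^ s) x∈R (m^n>0 2 s) (from-yes (3 <? 4))
                     (I-≤-pow G 1 (λ h → h) ∣R-x∣)
                     (I-≤-pow G 0 R-Nx⊆R-x-y refl) ⟩
  4 * 2 ^ s     ≡⟨ ^-distribˡ-+-* 2 2 s ⟨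
  2 ^ (2 + s)   ≡⟨ cong (2 ^_) (size-remove₂ R x∈R y∈R x≢y) ⟨
  2 ^ size R ∎
  where
  open ≤-Reasoning
  x≢y = adjacent⇒≢ G x~y
  s = size (R - x - y)
  ∣R-x∣ : size (R - x) ≡ 1 + s
  ∣R-x∣ = size-remove (R - x) (∈-remove⁺ y∈R λ y≡x → x≢y (sym y≡x))
  R-Nx⊆R-x-y : R -N[ G ] x ⊆ R - x - y
  R-Nx⊆R-x-y h with ∈-removeN⁻ {G = G} h
  ... | u∈R , u≢x , x≁u =
    ∈-remove⁺ (∈-remove⁺ u∈R u≢x) (neighbour≢non-neighbour G x~y x≁u)

affine-≤ : ∀ a b c d x → 0 < x → a ≤ c → a + b ≤ c + d → a * x + b ≤ c * x + d
affine-≤ a b c d x 0<x a≤c a+b≤c+d = begin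
  a * x + b           ≤⟨ +-monoʳ-≤ (a * x) b≤e+d ⟩
  a * x + (e + d)     ≤⟨ +-monoʳ-≤ (a * x) (+-monoˡ-≤ d (m≤m*n e x {{>-nonZero 0<x}})) ⟩
  a * x + (e * x + d) ≡⟨ +-assoc (a * x) (e * x) d ⟨
  a * x + e * x + d   ≡⟨ cong (_+ d) (*-distribʳ-+ x a e) ⟨
  (a + e) * x + d     ≡⟨ cong (λ t → t * x + d) (m+[n∸m]≡n a≤c) ⟩
  c * x + d ∎
  where
  open ≤-Reasoning
  e = c ∸ a
  b≤e+d : b ≤ e + d
  b≤e+d = +-cancelˡ-≤ a b (e + d)
    (subst (a + b ≤_) (trans (cong (_+ d) (sym (m+[n∸m]≡n a≤c))) (+-assoc a e d)) a+b≤c+d)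

-- The extremal value for k vertices: i(K₃) = 4, and i(K_{2,k-2}) = 2^(k-2) + 3 for k ≥ 4.
maxI : ℕ → ℕ
maxI 3 = 4
maxI k = 2 ^ (k ∸ 2) + 3

maxI-step : ∀ s → maxI (4 + s) + 2 ^ (2 + s) ≡ maxI (5 + s)
maxI-step s = double (2 ^ (2 + s))
  where
  double : ∀ x → (x + 3) + x ≡ (x + (x + 0)) + 3
  double = solve-∀

maxI-step-< : ∀ t → maxI (3 + t) + 2 ^ t < maxI (4 + t)
maxI-step-< zero    = from-yes (5 <? 7)
maxI-step-< (suc t) = begin
  suc ((2 * (2 * x) + 3) + 2 * x) ≡⟨ lhs x ⟩
  6 * x + 4                       ≤⟨ affine-≤ 6 4 8 3 x (m^n>0 2 t) (from-yes (6 ≤? 8)) (from-yes (10 ≤? 11)) ⟩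
  8 * x + 3                       ≡⟨ rhs x ⟨
  2 * (2 * (2 * x)) + 3 ∎
  where
  open ≤-Reasoning
  x = 2 ^ t
  lhs : ∀ x → suc ((2 * (2 * x) + 3) + 2 * x) ≡ 6 * x + 4
  lhs = solve-∀
  rhs : ∀ x → 2 * (2 * (2 * x)) + 3 ≡ 8 * x + 3
  rhs = solve-∀

maxI-four-copies : ∀ m → 3 ≤ m → 4 * maxI m < maxI (3 + m)
maxI-four-copies 0 ()
maxI-four-copies 1 (s≤s ())
maxI-four-copies 2 (s≤s (s≤s ()))
maxI-four-copies 3 _ = from-yes (16 <? 19)
maxI-four-copies (suc (suc (suc (suc t)))) _ = begin
  suc (4 * (2 * (2 * x) + 3))     ≡⟨ lhs x ⟩
  16 * x + 13                     ≤⟨ affine-≤ 16 13 32 3 x (m^n>0 2 t) (from-yes (16 ≤? 32)) (from-yes (29 ≤? 35)) ⟩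
  32 * x + 3                      ≡⟨ rhs x ⟨
  2 * (2 * (2 * (2 * (2 * x)))) + 3 ∎
  where
  open ≤-Reasoning
  x = 2 ^ t
  lhs : ∀ x → suc (4 * (2 * (2 * x) + 3)) ≡ 16 * x + 13
  lhs = solve-∀
  rhs : ∀ x → 2 * (2 * (2 * (2 * (2 * x)))) + 3 ≡ 32 * x + 3
  rhs = solve-∀

record K2Shape {n} (G : Graph n) (X : VSet n) : Set where
  field
    a b     : Fin n
    a∈X     : a ∈ X
    b∈X     : b ∈ X
    a≢b     : a ≢ b
    a≁b     : adj G a b ≡ false
    ~a      : ∀ {x} → x ∈ X → x ≢ a → x ≢ b → adj G x a ≡ true
    ~b      : ∀ {x} → x ∈ X → x ≢ a → x ≢ b → adj G x b ≡ true
    leaves-stable : Stable G (X - a - b)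

-- i(K_{2,j}) = 2^j + 3: the 2^j sets avoiding both centres, and {a}, {b}, {a, b}.
I-K2Shape : ∀ {n} (G : Graph n) (X : VSet n) j → size X ≡ 2 + j → K2Shape G X → I G X ≡ 2 ^ j + 3
I-K2Shape G X j ∣X∣ shape = begin
  I G X                                              ≡⟨ I-split G X a∈X ⟩
  I G (X - a) + I G (X -N[ G ] a)                    ≡⟨ cong (_+ I G (X -N[ G ] a)) (I-split G (X - a) b∈X-a) ⟩
  (I G (X - a - b) + I G (X - a -N[ G ] b)) + I G (X -N[ G ] a)
     ≡⟨ cong₂ (λ s t → (s + I G (X - a -N[ G ] b)) + t) leaves only-b ⟩
  (2 ^ j + I G (X - a -N[ G ] b)) + 2                ≡⟨ cong (λ t → (2 ^ j + t) + 2) (I-empty G _ not-b) ⟩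
  (2 ^ j + 1) + 2                                    ≡⟨ +-assoc (2 ^ j) 1 2 ⟩
  2 ^ j + 3 ∎
  where
  open ≡-Reasoning
  open K2Shape shape
  b∈X-a : b ∈ X - a
  b∈X-a = ∈-remove⁺ b∈X λ b≡a → a≢b (sym b≡a)
  leaves : I G (X - a - b) ≡ 2 ^ j
  leaves = trans (I-stable G (X - a - b) leaves-stable)
                 (cong (2 ^_) (suc-injective (suc-injective (trans (sym (size-remove₂ X a∈X b∈X a≢b)) ∣X∣))))
  not-b : ∀ u → u ∉ X - a -N[ G ] b
  not-b u h with ∈-removeN⁻ {G = G} h
  ... | u∈X-a , u≢b , b≁u with ∈-remove⁻ u∈X-a
  ... | u∈X , u≢a = contradiction (trans (sym (~b u∈X u≢a u≢b)) (trans (adj-sym G u b) b≁u)) λ ()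
  not-a : ∀ u → u ∉ X -N[ G ] a - b
  not-a u h with ∈-remove⁻ h
  ... | u∈X-Na , u≢b with ∈-removeN⁻ {G = G} u∈X-Na
  ... | u∈X , u≢a , a≁u = contradiction (trans (sym (~a u∈X u≢a u≢b)) (trans (adj-sym G u a) a≁u)) λ ()
  only-b : I G (X -N[ G ] a) ≡ 2
  only-b = begin
    I G (X -N[ G ] a)                                     ≡⟨ I-split G (X -N[ G ] a) b∈X-Na ⟩
    I G (X -N[ G ] a - b) + I G (X -N[ G ] a -N[ G ] b)   ≡⟨ cong₂ _+_ (I-empty G _ not-a)
                                                              (I-empty G _ λ u h → not-a u (removeN-⊆-remove {G = G} h)) ⟩
    2 ∎
    where
    b∈X-Na = ∈-removeN⁺ {G = G} b∈X (λ b≡a → a≢b (sym b≡a)) a≁b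

-- A pendant triangle on an independent set of m ≥ 1 vertices stays below maxI (3 + m).
maxI-triangle-< : ∀ m → 0 < m → ((2 ^ m + 1) + 1) + 2 ^ m < maxI (3 + m)
maxI-triangle-< (suc s) _ = ≤-reflexive (identity (2 ^ suc s))
  where
  identity : ∀ x → suc (((x + 1) + 1) + x) ≡ (x + (x + 0)) + 3
  identity = solve-∀

pow-size : ∀ {n} (Y : VSet n) j s → size Y ≡ j + s → 2 ^ j * 2 ^ s ≡ 2 ^ size Y
pow-size Y j s ∣Y∣ = sym (trans (cong (2 ^_) ∣Y∣) (^-distribˡ-+-* 2 j s))

-- The
-- independent sets of G[R] plus those of G[R - N[d]] number at most 2^|R|, and
-- fewer if |R| ≥ 3.  (Used when a pendant triangle is attached to R at d.)
module NeighbourhoodBound {n} (G : Graph n) (R : VSet n) {d e : Fin n} (d∈R : d ∈ R) (e∈R : e ∈ R)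
  (d~e : adj G d e ≡ true) (has-neighbour : ∀ {z} → z ∈ R → ∃[ w ] w ∈ R × adj G z w ≡ true) where

  private
    d≢e = adjacent⇒≢ G d~e
    t = size (R - d - e)
    e∈R-d : e ∈ R - d
    e∈R-d = ∈-remove⁺ e∈R λ e≡d → d≢e (sym e≡d)
    ∣R∣ : size R ≡ 2 + t
    ∣R∣ = size-remove₂ R d∈R e∈R d≢e
    ∣R-d∣ : size (R - d) ≡ 1 + t
    ∣R-d∣ = size-remove (R - d) e∈R-d
    R-Nd⊆R-d-e : R -N[ G ] d ⊆ R - d - e
    R-Nd⊆R-d-e h with ∈-removeN⁻ {G = G} h
    ... | u∈R , u≢d , d≁u =
      ∈-remove⁺ (∈-remove⁺ u∈R u≢d) (neighbour≢non-neighbour G d~e d≁u)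
    doubled : I G R + I G (R -N[ G ] d) ≡ I G (R - d) + (I G (R -N[ G ] d) + I G (R -N[ G ] d))
    doubled = trans (cong (_+ I G (R -N[ G ] d)) (I-split G R d∈R)) (+-assoc (I G (R - d)) _ _)

  I-with-N-≤ : I G R + I G (R -N[ G ] d) ≤ 2 ^ size R
  I-with-N-≤ = begin
    I G R + I G (R -N[ G ] d)                                   ≡⟨ doubled ⟩
    I G (R - d) + (I G (R -N[ G ] d) + I G (R -N[ G ] d))       ≤⟨ sum-≤ 2 2 (2 ^ t) (I-≤-pow G 1 id ∣R-d∣)
                                                                     (sum-≤ 1 1 (2 ^ t) R-Nd≤ R-Nd≤) ⟩
    4 * 2 ^ t                                                   ≡⟨ pow-size R 2 t ∣R∣ ⟩
    2 ^ size R ∎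
    where
    open ≤-Reasoning
    R-Nd≤ = I-≤-pow G 0 R-Nd⊆R-d-e refl

  -- For the strict bound pick a third vertex z; either d ~ z shrinks R - N[d]
  -- further, or a neighbour w ≠ d of z shrinks R - d - N[z].
  I-with-N-< : 3 ≤ size R → I G R + I G (R -N[ G ] d) < 2 ^ size R
  I-with-N-< 3≤∣R∣ with nonempty-member (R - d - e) (≤-pred (≤-pred (subst (3 ≤_) ∣R∣ 3≤∣R∣)))
  ... | z , z∈R-d-e with ∈-remove⁻ z∈R-d-e
  ... | z∈R-d , z≢e with ∈-remove⁻ z∈R-d
  ... | z∈R , z≢d = bound (adj G d z) refl
    where
    open ≤-Reasoning
    t′ = size (R - d - e - z)
    ∣R-d-e∣ : t ≡ 1 + t′
    ∣R-d-e∣ = size-remove (R - d - e) z∈R-d-e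
    ∣R∣′ : size R ≡ 3 + t′
    ∣R∣′ = trans ∣R∣ (cong (2 +_) ∣R-d-e∣)
    ∣R-d∣′ : size (R - d) ≡ 2 + t′
    ∣R-d∣′ = trans ∣R-d∣ (cong suc ∣R-d-e∣)
    finish : ∀ a b → a + b < 8 → I G (R - d) ≤ a * 2 ^ t′ → I G (R -N[ G ] d) + I G (R -N[ G ] d) ≤ b * 2 ^ t′ →
      I G R + I G (R -N[ G ] d) < 2 ^ size R
    finish a b a+b<8 ≤₁ ≤₂ = begin-strict
      I G R + I G (R -N[ G ] d)                              ≡⟨ doubled ⟩
      I G (R - d) + (I G (R -N[ G ] d) + I G (R -N[ G ] d))  <⟨ sum-< a b 8 (2 ^ t′) (m^n>0 2 t′) a+b<8 ≤₁ ≤₂ ⟩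
      8 * 2 ^ t′                                             ≡⟨ pow-size R 3 t′ ∣R∣′ ⟩
      2 ^ size R ∎
    bound : ∀ b → adj G d z ≡ b → I G R + I G (R -N[ G ] d) < 2 ^ size R
    bound true d~z = finish 4 2 (from-yes (6 <? 8)) (I-≤-pow G 2 id ∣R-d∣′) (sum-≤ 1 1 (2 ^ t′) R-Nd≤ R-Nd≤)
      where
      R-Nd≤ : I G (R -N[ G ] d) ≤ 1 * 2 ^ t′
      R-Nd≤ = I-≤-pow G 0 (λ h → ∈-remove⁺ (R-Nd⊆R-d-e h)
                (neighbour≢non-neighbour G d~z (proj₂ (proj₂ (∈-removeN⁻ {G = G} h))))) refl
    bound false d≁z with has-neighbour z∈R
    ... | w , w∈R , z~w = finish 3 4 (from-yes (7 <? 8)) R-d≤ (sum-≤ 2 2 (2 ^ t′) R-Nd≤ R-Nd≤)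
      where
      z≢w = adjacent⇒≢ G z~w
      w∈R-d-z : w ∈ R - d - z
      w∈R-d-z = ∈-remove⁺ (∈-remove⁺ w∈R λ { refl → contradiction (trans (sym d≁z) (trans (adj-sym G w z) z~w)) λ () })
                  λ w≡z → z≢w (sym w≡z)
      ∣R-d-z∣ : size (R - d - z) ≡ 1 + t′
      ∣R-d-z∣ = suc-injective (trans (sym (size-remove (R - d) z∈R-d)) ∣R-d∣′)
      ∣R-d-z-w∣ : size (R - d - z - w) ≡ t′
      ∣R-d-z-w∣ = suc-injective (trans (sym (size-remove (R - d - z) w∈R-d-z)) ∣R-d-z∣)
      R-d≤ : I G (R - d) ≤ 3 * 2 ^ t′
      R-d≤ = I-split-≤ G (R - d) 2 1 (2 ^ t′) z∈R-d (I-≤-pow G 1 id ∣R-d-z∣)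
        (I-≤-pow G 0 (λ h → let (u∈R-d , u≢z , z≁u) = ∈-removeN⁻ {G = G} h in
           ∈-remove⁺ (∈-remove⁺ u∈R-d u≢z) (neighbour≢non-neighbour G z~w z≁u))
          ∣R-d-z-w∣)
      R-Nd≤ : I G (R -N[ G ] d) ≤ 2 * 2 ^ t′
      R-Nd≤ = I-≤-pow G 1 R-Nd⊆R-d-e ∣R-d-e∣

rescale : ∀ a {s s′} → s ≡ suc s′ → a * 2 ^ s ≡ (a * 2) * 2 ^ s′
rescale a {s′ = s′} refl = sym (*-assoc a 2 (2 ^ s′))

-- If C is non-empty then i(G[C]) + i(G[R]) < 2^|R|.  (C arises as the
-- part of R left after deleting two closed neighbourhoods.)
module CBound {n} (G : Graph n) (R C : VSet n) (C⊆R : C ⊆ R)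
  (C-neighbours : ∀ {c} → c ∈ C → TwoNeighbours G R c) {r₀ : Fin n} (r₀∈R : r₀ ∈ R) (r₀∉C : r₀ ∉ C) where

  private
    ∉C⇒≢ : ∀ {u w} → u ∈ C → w ∉ C → u ≢ w
    ∉C⇒≢ u∈C w∉C refl = w∉C u∈C

  module AtVertex {c p q : Fin n} (c∈C : c ∈ C) (p≢q : p ≢ q) (p∈R : p ∈ R) (q∈R : q ∈ R)
    (c~p : adj G c p ≡ true) (c~q : adj G c q ≡ true) where

    c∈R = C⊆R c∈C
    c≢p = adjacent⇒≢ G c~p
    c≢q = adjacent⇒≢ G c~q
    s = size (R - c - p - q)
    ∣R∣ : size R ≡ 3 + s
    ∣R∣ = size-remove₃ R c∈R p∈R q∈R c≢p c≢q p≢q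
    ∣R-c∣ : size (R - c) ≡ 2 + s
    ∣R-c∣ = suc-injective (trans (sym (size-remove R c∈R)) ∣R∣)

    ∈R-c-p-q : ∀ {u} → u ∈ R → u ≢ c → u ≢ p → u ≢ q → u ∈ R - c - p - q
    ∈R-c-p-q u∈R u≢c u≢p u≢q = ∈-remove⁺ (∈-remove⁺ (∈-remove⁺ u∈R u≢c) u≢p) u≢q

    N[c]-⊆ : ∀ {Y} → Y ⊆ R → Y -N[ G ] c ⊆ R - c - p - q
    N[c]-⊆ {Y} Y⊆R h with ∈-removeN⁻ {G = G} h
    ... | u∈Y , u≢c , c≁u =
      ∈R-c-p-q (Y⊆R u∈Y) u≢c (neighbour≢non-neighbour G c~p c≁u) (neighbour≢non-neighbour G c~q c≁u)

    R-Nc≤ : I G (R -N[ G ] c) ≤ 1 * 2 ^ s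
    R-Nc≤ = I-≤-pow G 0 (N[c]-⊆ id) refl

    C-Nc≤ : I G (C -N[ G ] c) ≤ 1 * 2 ^ s
    C-Nc≤ = I-≤-pow G 0 (N[c]-⊆ C⊆R) refl

    R≤ : I G R ≤ 5 * 2 ^ s
    R≤ = I-split-≤ G R 4 1 (2 ^ s) c∈R (I-≤-pow G 2 id ∣R-c∣) R-Nc≤

    p∈R-c : p ∈ R - c
    p∈R-c = ∈-remove⁺ p∈R (c≢p ∘′ sym)
    ∣R-c-p∣ : size (R - c - p) ≡ 1 + s
    ∣R-c-p∣ = size-remove (R - c - p) (∈-remove⁺ (∈-remove⁺ q∈R (c≢q ∘′ sym)) (p≢q ∘′ sym))
    ∣R-c-q∣ : size (R - c - q) ≡ 1 + s
    ∣R-c-q∣ = suc-injective (trans (sym (size-remove (R - c) (∈-remove⁺ q∈R (c≢q ∘′ sym)))) ∣R-c∣)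

    conclude : ∀ j s′ a b → size R ≡ j + s′ → a + b < 2 ^ j → I G C ≤ a * 2 ^ s′ → I G R ≤ b * 2 ^ s′ →
      I G C + I G R < 2 ^ size R
    conclude j s′ a b ∣R∣′ a+b< C≤ R≤′ = subst (I G C + I G R <_) (pow-size R j s′ ∣R∣′)
      (sum-< a b (2 ^ j) (2 ^ s′) (m^n>0 2 s′) a+b< C≤ R≤′)

    r₀-elsewhere : r₀ ≢ p → r₀ ≢ q → I G C + I G R < 2 ^ size R
    r₀-elsewhere r₀≢p r₀≢q = conclude 4 s₄ 5 10 ∣R∣′ (from-yes (15 <? 16)) C≤ (subst (I G R ≤_) (rescale 5 ∣R-c-p-q∣) R≤)
      where
      r₀∈R-c-p-q : r₀ ∈ R - c - p - q
      r₀∈R-c-p-q = ∈R-c-p-q r₀∈R (∉C⇒≢ c∈C r₀∉C ∘′ sym) r₀≢p r₀≢q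
      s₄ = size (R - c - p - q - r₀)
      ∣R-c-p-q∣ : s ≡ suc s₄
      ∣R-c-p-q∣ = size-remove (R - c - p - q) r₀∈R-c-p-q
      ∣R∣′ : size R ≡ 4 + s₄
      ∣R∣′ = trans ∣R∣ (cong (3 +_) ∣R-c-p-q∣)
      ∣R-c-r₀∣ : size (R - c - r₀) ≡ 2 + s₄
      ∣R-c-r₀∣ = suc-injective (trans (sym (size-remove (R - c) (remove-⊆ (remove-⊆ r₀∈R-c-p-q)))) (trans ∣R-c∣ (cong (2 +_) ∣R-c-p-q∣)))
      C≤ : I G C ≤ 5 * 2 ^ s₄
      C≤ = I-split-≤ G C 4 1 (2 ^ s₄) c∈C
        (I-≤-pow G 2 (λ h → let (u∈C , u≢c) = ∈-remove⁻ h in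
           ∈-remove⁺ (∈-remove⁺ (C⊆R u∈C) u≢c) (∉C⇒≢ u∈C r₀∉C)) ∣R-c-r₀∣)
        (I-≤-pow G 0 (λ h → ∈-remove⁺ (N[c]-⊆ C⊆R h) (∉C⇒≢ (proj₁ (∈-removeN⁻ {G = G} h)) r₀∉C)) refl)

    -- r₀ = q, so q ∉ C: either p ∉ C and C - c avoids p and q, or p ∈ C and a
    -- further neighbour w ≠ c of p improves the bound on R (if w = q) or on C.
    q-outside : q ∉ C → I G C + I G R < 2 ^ size R
    q-outside q∉C with p ∈? C
    ... | no p∉C = conclude 3 s 2 5 ∣R∣ (from-yes (7 <? 8)) C≤ R≤
      where
      C≤ : I G C ≤ 2 * 2 ^ s
      C≤ = I-split-≤ G C 1 1 (2 ^ s) c∈C (I-≤-pow G 0 (λ h → let (u∈C , u≢c) = ∈-remove⁻ h in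
             ∈R-c-p-q (C⊆R u∈C) u≢c (∉C⇒≢ u∈C p∉C) (∉C⇒≢ u∈C q∉C)) refl) C-Nc≤
    ... | yes p∈C with another-neighbour (C-neighbours p∈C) c
    ... | w , w∈R , p~w , w≢c with w ≟ᶠ q
    ...   | yes refl = conclude 3 s 3 4 ∣R∣ (from-yes (7 <? 8)) C≤ R≤′
      where
      C≤ : I G C ≤ 3 * 2 ^ s
      C≤ = I-split-≤ G C 2 1 (2 ^ s) c∈C (I-≤-pow G 1 (λ h → let (u∈C , u≢c) = ∈-remove⁻ h in
             ∈-remove⁺ (∈-remove⁺ (C⊆R u∈C) u≢c) (∉C⇒≢ u∈C q∉C)) ∣R-c-q∣) C-Nc≤
      R≤′ : I G R ≤ 4 * 2 ^ s
      R≤′ = I-split-≤ G R 3 1 (2 ^ s) c∈R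
        (I-split-≤ G (R - c) 2 1 (2 ^ s) p∈R-c (I-≤-pow G 1 id ∣R-c-p∣)
          (I-≤-pow G 0 (λ h → let (u∈R-c , u≢p , p≁u) = ∈-removeN⁻ {G = G} h in
             ∈-remove⁺ (∈-remove⁺ u∈R-c u≢p) (neighbour≢non-neighbour G p~w p≁u)) refl))
        R-Nc≤
    ...   | no w≢q = conclude 4 s₄ 5 10 ∣R∣′ (from-yes (15 <? 16)) C≤ (subst (I G R ≤_) (rescale 5 ∣R-c-p-q∣) R≤)
      where
      w∈R-c-p-q : w ∈ R - c - p - q
      w∈R-c-p-q = ∈R-c-p-q w∈R w≢c (adjacent⇒≢ G p~w ∘′ sym) w≢q
      s₄ = size (R - c - p - q - w)
      ∣R-c-p-q∣ : s ≡ suc s₄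
      ∣R-c-p-q∣ = size-remove (R - c - p - q) w∈R-c-p-q
      ∣R∣′ : size R ≡ 4 + s₄
      ∣R∣′ = trans ∣R∣ (cong (3 +_) ∣R-c-p-q∣)
      C-c≤ : I G (C - c) ≤ 3 * 2 ^ s₄
      C-c≤ = I-split-≤ G (C - c) 2 1 (2 ^ s₄) (∈-remove⁺ p∈C (c≢p ∘′ sym))
        (I-≤-pow G 1 (λ h → let (u∈C-c , u≢p) = ∈-remove⁻ h ; (u∈C , u≢c) = ∈-remove⁻ u∈C-c in
           ∈R-c-p-q (C⊆R u∈C) u≢c u≢p (∉C⇒≢ u∈C q∉C)) ∣R-c-p-q∣)
        (I-≤-pow G 0 (λ h → let (u∈C-c , u≢p , p≁u) = ∈-removeN⁻ {G = G} h ; (u∈C , u≢c) = ∈-remove⁻ u∈C-c in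
           ∈-remove⁺ (∈R-c-p-q (C⊆R u∈C) u≢c u≢p (∉C⇒≢ u∈C q∉C)) (neighbour≢non-neighbour G p~w p≁u)) refl)
      C≤ : I G C ≤ 5 * 2 ^ s₄
      C≤ = I-split-≤ G C 3 2 (2 ^ s₄) c∈C C-c≤ (subst (I G (C -N[ G ] c) ≤_) (rescale 1 ∣R-c-p-q∣) C-Nc≤)

  I-C+R-< : ∀ {c} → c ∈ C → I G C + I G R < 2 ^ size R
  I-C+R-< c∈C with C-neighbours c∈C
  ... | twoNeighbours {p} {q} p≢q p∈R q∈R c~p c~q with r₀ ≟ᶠ p | r₀ ≟ᶠ q
  ... | yes refl | _        = AtVertex.q-outside c∈C (p≢q ∘′ sym) q∈R p∈R c~q c~p r₀∉C
  ... | no _     | yes refl = AtVertex.q-outside c∈C p≢q p∈R q∈R c~p c~q r₀∉C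
  ... | no r₀≢p  | no r₀≢q  = AtVertex.r₀-elsewhere c∈C p≢q p∈R q∈R c~p c~q r₀≢p r₀≢q

  I-C+R : ∀ {x y} → x ∈ R → y ∈ R → adj G x y ≡ true →
    (I G C + I G R ≤ 2 ^ size R) × (3 ≤ size R → I G C + I G R < 2 ^ size R)
  I-C+R {x} {y} x∈R y∈R x~y with any? (_∈? C)
  ... | yes (c , c∈C) = <⇒≤ (I-C+R-< c∈C) , λ _ → I-C+R-< c∈C
  ... | no no-C = at-most , below
    where
    open ≤-Reasoning
    x≢y = adjacent⇒≢ G x~y
    s = size (R - x - y)
    ∣R∣ : size R ≡ 2 + s
    ∣R∣ = size-remove₂ R x∈R y∈R x≢y
    I-C≡1 : I G C ≡ 1
    I-C≡1 = I-empty G C λ u u∈C → no-C (u , u∈C)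
    R≤ : I G R ≤ 3 * 2 ^ s
    R≤ = I-split-≤ G R 2 1 (2 ^ s) x∈R (I-≤-pow G 1 id (size-remove (R - x) (∈-remove⁺ y∈R (x≢y ∘′ sym))))
      (I-≤-pow G 0 (λ h → let (u∈R , u≢x , x≁u) = ∈-removeN⁻ {G = G} h in
         ∈-remove⁺ (∈-remove⁺ u∈R u≢x) (neighbour≢non-neighbour G x~y x≁u)) refl)
    one≤ : ∀ t → 1 ≤ 1 * 2 ^ t
    one≤ t = subst (1 ≤_) (sym (*-identityˡ (2 ^ t))) (m^n>0 2 t)
    at-most : I G C + I G R ≤ 2 ^ size R
    at-most = begin
      I G C + I G R ≤⟨ sum-≤ 1 3 (2 ^ s) (≤-trans (≤-reflexive I-C≡1) (one≤ s)) R≤ ⟩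
      4 * 2 ^ s     ≡⟨ pow-size R 2 s ∣R∣ ⟩
      2 ^ size R ∎
    below : 3 ≤ size R → I G C + I G R < 2 ^ size R
    below 3≤∣R∣ with nonempty-member (R - x - y) (≤-pred (≤-pred (subst (3 ≤_) ∣R∣ 3≤∣R∣)))
    ... | z , z∈ = begin-strict
      I G C + I G R <⟨ sum-< 1 6 8 (2 ^ s′) (m^n>0 2 s′) (from-yes (7 <? 8))
                        (≤-trans (≤-reflexive I-C≡1) (one≤ s′)) (subst (I G R ≤_) (rescale 3 ∣R-x-y∣) R≤) ⟩
      8 * 2 ^ s′    ≡⟨ pow-size R 3 s′ (trans ∣R∣ (cong (2 +_) ∣R-x-y∣)) ⟩
      2 ^ size R ∎
      where
      s′ = size (R - x - y - z)
      ∣R-x-y∣ : s ≡ suc s′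
      ∣R-x-y∣ = size-remove (R - x - y) z∈

data Outcome {n} (G : Graph n) (X : VSet n) (k : ℕ) : Set where
  below       : I G X < maxI k → Outcome G X k
  exceptional : k ≡ 3 ⊎ k ≡ 5 → I G X ≤ maxI k → Outcome G X k
  extremal    : 4 ≤ k → K2Shape G X → Outcome G X k

outcome-bound : ∀ {n} {G : Graph n} {X : VSet n} → Outcome G X (size X) → I G X ≤ maxI (size X)
outcome-bound (below I<)         = <⇒≤ I<
outcome-bound (exceptional _ I≤) = I≤
outcome-bound {G = G} {X} (extremal 4≤k shape) = K2-bound (size X) refl 4≤k
  where
  K2-bound : ∀ k → size X ≡ k → 4 ≤ k → I G X ≤ maxI k
  K2-bound 1 _ (s≤s ())
  K2-bound 2 _ (s≤s (s≤s ()))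
  K2-bound 3 _ (s≤s (s≤s (s≤s ())))
  K2-bound (suc (suc (suc (suc j)))) ∣X∣ _ = ≤-reflexive (I-K2Shape G X (2 + j) ∣X∣ shape)

BoundBelow : ℕ → ℕ → Set
BoundBelow n k = ∀ (G : Graph n) (X : VSet n) → 3 ≤ size X → size X < k → MinDeg2 G X → I G X ≤ maxI (size X)

record ThreeNeighbours {n} (G : Graph n) (X : VSet n) (x : Fin n) : Set where
  constructor threeNeighbours
  field
    {p q r}     : Fin n
    p≢q         : p ≢ q
    p≢r         : p ≢ r
    q≢r         : q ≢ r
    p∈X         : p ∈ X
    q∈X         : q ∈ X
    r∈X         : r ∈ X
    x~p         : adj G x p ≡ true
    x~q         : adj G x q ≡ true
    x~r         : adj G x r ≡ true

ExactlyTwo : ∀ {n} → Graph n → VSet n → Fin n → Fin n → Fin n → Set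
ExactlyTwo G X v a b = v ∈ X × a ≢ b × a ∈ X × b ∈ X × adj G v a ≡ true × adj G v b ≡ true ×
  (∀ w → w ∈ X → adj G v w ≡ true → w ≡ a ⊎ w ≡ b)

exactly-two? : ∀ {n} (G : Graph n) (X : VSet n) v a b → Dec (ExactlyTwo G X v a b)
exactly-two? G X v a b = v ∈? X ×-dec ¬? (a ≟ᶠ b) ×-dec a ∈? X ×-dec b ∈? X ×-dec
  adj G v a ≟ᵇ true ×-dec adj G v b ≟ᵇ true ×-dec
  all? (λ w → w ∈? X →-dec (adj G v w ≟ᵇ true →-dec (w ≟ᶠ a ⊎-dec w ≟ᶠ b)))

third-or-only : ∀ {n} (G : Graph n) (X : VSet n) x p q →
  (∃[ w ] w ∈ X × adj G x w ≡ true × w ≢ p × w ≢ q) ⊎ (∀ w → w ∈ X → adj G x w ≡ true → w ≡ p ⊎ w ≡ q)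
third-or-only G X x p q with any? (λ w → w ∈? X ×-dec adj G x w ≟ᵇ true ×-dec ¬? (w ≟ᶠ p) ×-dec ¬? (w ≟ᶠ q))
... | yes third   = inj₁ third
... | no no-third = inj₂ only
  where
  only : ∀ w → w ∈ X → adj G x w ≡ true → w ≡ p ⊎ w ≡ q
  only w w∈X x~w with w ≟ᶠ p | w ≟ᶠ q
  ... | yes w≡p | _       = inj₁ w≡p
  ... | no _    | yes w≡q = inj₂ w≡q
  ... | no w≢p  | no w≢q  = contradiction (w , w∈X , x~w , w≢p , w≢q) no-third

degree-two-or-three : ∀ {n} {G : Graph n} {X : VSet n} → MinDeg2 G X →
  (∃[ v ] ∃[ a ] ∃[ b ] ExactlyTwo G X v a b) ⊎ (∀ {x} → x ∈ X → ThreeNeighbours G X x)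
degree-two-or-three {n} {G} {X} deg with any? (λ v → any? (λ a → any? (λ b → exactly-two? G X v a b)))
... | yes (v , a , b , two) = inj₁ (v , a , b , two)
... | no none = inj₂ three
  where
  three : ∀ {x} → x ∈ X → ThreeNeighbours G X x
  three {x} x∈X with deg x∈X
  ... | twoNeighbours {p} {q} p≢q p∈X q∈X x~p x~q with third-or-only G X x p q
  ... | inj₁ (w , w∈X , x~w , w≢p , w≢q) =
    threeNeighbours p≢q (w≢p ∘′ sym) (w≢q ∘′ sym) p∈X q∈X w∈X x~p x~q x~w
  ... | inj₂ only = contradiction (x , p , q , x∈X , p≢q , p∈X , q∈X , x~p , x~q , only) none

-- If every vertex has three neighbours in X, deleting any vertex z keeps the
-- minimum degree ≥ 2, and i(G[X]) ≤ maxI (k - 1) + 2^(k - 4) < maxI k.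
all-degree-three : ∀ {n k} → BoundBelow n k → (G : Graph n) (X : VSet n) → size X ≡ k → 3 ≤ k →
  (∀ {x} → x ∈ X → ThreeNeighbours G X x) → I G X < maxI k
all-degree-three {n} {k} ih G X ∣X∣ 3≤k three
  with nonempty-member X (≤-trans (s≤s z≤n) (subst (3 ≤_) (sym ∣X∣) 3≤k))
... | z , z∈X with three z∈X
... | threeNeighbours {p} {q} {r} p≢q p≢r q≢r p∈X q∈X r∈X z~p z~q z~r = begin-strict
  I G X                              ≡⟨ I-split G X z∈X ⟩
  I G (X - z) + I G (X -N[ G ] z)    ≤⟨ +-mono-≤ X-z≤ (I-≤-2^-⊇ G X-Nz⊆) ⟩
  maxI (3 + t) + 2 ^ t               <⟨ maxI-step-< t ⟩
  maxI (4 + t)                       ≡⟨ cong maxI ∣X∣′ ⟨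
  maxI k ∎
  where
  open ≤-Reasoning
  t = size (X - z - p - q - r)
  ∣X-z∣ : size (X - z) ≡ 3 + t
  ∣X-z∣ = size-remove₃ (X - z) (∈-remove⁺ p∈X (adjacent⇒≢ G z~p ∘′ sym)) (∈-remove⁺ q∈X (adjacent⇒≢ G z~q ∘′ sym))
    (∈-remove⁺ r∈X (adjacent⇒≢ G z~r ∘′ sym)) p≢q p≢r q≢r
  ∣X∣′ : k ≡ 4 + t
  ∣X∣′ = trans (sym ∣X∣) (trans (size-remove X z∈X) (cong suc ∣X-z∣))
  -- at most one of the three neighbours of a vertex of X - z is z
  deg′ : MinDeg2 G (X - z)
  deg′ {x} x∈X-z with ∈-remove⁻ x∈X-z
  ... | x∈X , x≢z with three x∈X
  ... | threeNeighbours {p′} {q′} {r′} p′≢q′ p′≢r′ q′≢r′ p′∈X q′∈X r′∈X x~p′ x~q′ x~r′ with p′ ≟ᶠ z | q′ ≟ᶠ z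
  ...   | yes refl | _        = twoNeighbours q′≢r′ (∈-remove⁺ q′∈X (p′≢q′ ∘′ sym)) (∈-remove⁺ r′∈X (p′≢r′ ∘′ sym)) x~q′ x~r′
  ...   | no p′≢z  | yes refl = twoNeighbours p′≢r′ (∈-remove⁺ p′∈X p′≢z) (∈-remove⁺ r′∈X (q′≢r′ ∘′ sym)) x~p′ x~r′
  ...   | no p′≢z  | no q′≢z  = twoNeighbours p′≢q′ (∈-remove⁺ p′∈X p′≢z) (∈-remove⁺ q′∈X q′≢z) x~p′ x~q′
  X-z≤ : I G (X - z) ≤ maxI (3 + t)
  X-z≤ = subst (λ s → I G (X - z) ≤ maxI s) ∣X-z∣
    (ih G (X - z) (subst (3 ≤_) (sym ∣X-z∣) (m≤m+n 3 t))
       (subst (_< k) (sym ∣X-z∣) (subst (3 + t <_) (sym ∣X∣′) ≤-refl)) deg′)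
  X-Nz⊆ : X -N[ G ] z ⊆ X - z - p - q - r
  X-Nz⊆ h with ∈-removeN⁻ {G = G} h
  ... | u∈X , u≢z , z≁u = ∈-remove⁺ (∈-remove⁺ (∈-remove⁺ (∈-remove⁺ u∈X u≢z)
    (neighbour≢non-neighbour G z~p z≁u)) (neighbour≢non-neighbour G z~q z≁u)) (neighbour≢non-neighbour G z~r z≁u)

pendant-conclude : ∀ {n} {G : Graph n} {X : VSet n} {k} m {A B} → k ≡ 3 + m → 2 ≤ m →
  I G X ≡ A + B → A ≤ maxI (2 + m) → B ≤ 2 ^ m → (3 ≤ m → B < 2 ^ m) → Outcome G X k
pendant-conclude 1 refl (s≤s ())
pendant-conclude 2 refl _ I≡ A≤ B≤ _ = exceptional (inj₂ refl) (subst (_≤ 11) (sym I≡) (+-mono-≤ A≤ B≤))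
pendant-conclude {G = G} {X} (suc (suc (suc s))) {A} {B} refl _ I≡ A≤ _ B< = below (begin-strict
  I G X                        ≡⟨ I≡ ⟩
  A + B                        <⟨ +-mono-≤-< A≤ (B< (s≤s (s≤s (s≤s z≤n)))) ⟩
  maxI (5 + s) + 2 ^ (3 + s)   ≡⟨ maxI-step (1 + s) ⟩
  maxI (6 + s) ∎)
  where open ≤-Reasoning

-- Since N[v] = {v, a, b}, i(G[X]) = i(G[X - v]) + i(G[R]).
module Pendant {n k} (ih : BoundBelow n k) (G : Graph n) (X : VSet n) (∣X∣ : size X ≡ k) (deg : MinDeg2 G X)
  {v a b : Fin n} (v∈X : v ∈ X) (a≢b : a ≢ b) (a∈X : a ∈ X) (b∈X : b ∈ X)
  (v~a : adj G v a ≡ true) (v~b : adj G v b ≡ true)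
  (only-a-b : ∀ w → w ∈ X → adj G v w ≡ true → w ≡ a ⊎ w ≡ b) where

  v≢a = adjacent⇒≢ G v~a
  v≢b = adjacent⇒≢ G v~b
  X′ = X - v
  R  = X - v - a - b
  m  = size R

  k≡3+m : k ≡ 3 + m
  k≡3+m = trans (sym ∣X∣) (size-remove₃ X v∈X a∈X b∈X v≢a v≢b a≢b)

  ∣X′∣ : size X′ ≡ 2 + m
  ∣X′∣ = suc-injective (trans (sym (size-remove X v∈X)) (trans ∣X∣ k≡3+m))

  a∈X′ : a ∈ X′
  a∈X′ = ∈-remove⁺ a∈X (v≢a ∘′ sym)
  b∈X′ : b ∈ X′
  b∈X′ = ∈-remove⁺ b∈X (v≢b ∘′ sym)

  ∈R⁺ : ∀ {u} → u ∈ X → u ≢ v → u ≢ a → u ≢ b → u ∈ R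
  ∈R⁺ u∈X u≢v u≢a u≢b = ∈-remove⁺ (∈-remove⁺ (∈-remove⁺ u∈X u≢v) u≢a) u≢b

  ∈R⁻ : ∀ {u} → u ∈ R → u ∈ X × u ≢ v × u ≢ a × u ≢ b
  ∈R⁻ u∈R with ∈-remove⁻ u∈R
  ... | u∈X-v-a , u≢b with ∈-remove⁻ u∈X-v-a
  ... | u∈X-v , u≢a with ∈-remove⁻ u∈X-v
  ... | u∈X , u≢v = u∈X , u≢v , u≢a , u≢b

  R⊆X : R ⊆ X
  R⊆X u∈R = proj₁ (∈R⁻ u∈R)

  R-≢v : ∀ {u} → u ∈ R → u ≢ v
  R-≢v u∈R = proj₁ (proj₂ (∈R⁻ u∈R))
  R-≢a : ∀ {u} → u ∈ R → u ≢ a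
  R-≢a u∈R = proj₁ (proj₂ (proj₂ (∈R⁻ u∈R)))
  R-≢b : ∀ {u} → u ∈ R → u ≢ b
  R-≢b u∈R = proj₂ (proj₂ (proj₂ (∈R⁻ u∈R)))

  v≁R : ∀ {u} → u ∈ R → adj G v u ≡ false
  v≁R {u} u∈R with adj G v u in v~u
  ... | false = refl
  ... | true with only-a-b u (R⊆X u∈R) v~u
  ...   | inj₁ u≡a = contradiction u≡a (R-≢a u∈R)
  ...   | inj₂ u≡b = contradiction u≡b (R-≢b u∈R)

  R-neighbour≢v : ∀ {u w} → u ∈ R → adj G u w ≡ true → w ≢ v
  R-neighbour≢v {u} u∈R u~w refl = contradiction (trans (sym u~w) (trans (adj-sym G u v) (v≁R u∈R))) λ ()

  I-X : I G X ≡ I G X′ + I G R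
  I-X = trans (I-split G X v∈X) (cong (I G X′ +_) (I-cong G X-Nv⊆R R⊆X-Nv))
    where
    X-Nv⊆R : X -N[ G ] v ⊆ R
    X-Nv⊆R h with ∈-removeN⁻ {G = G} h
    ... | u∈X , u≢v , v≁u = ∈R⁺ u∈X u≢v (neighbour≢non-neighbour G v~a v≁u) (neighbour≢non-neighbour G v~b v≁u)
    R⊆X-Nv : R ⊆ X -N[ G ] v
    R⊆X-Nv u∈R = let (u∈X , u≢v , _) = ∈R⁻ u∈R in ∈-removeN⁺ {G = G} u∈X u≢v (v≁R u∈R)

  to-both-centres : ∀ {u} → u ∈ R → (∀ {w} → w ∈ R → adj G u w ≡ false) → adj G u a ≡ true × adj G u b ≡ true
  to-both-centres {u} u∈R isolated with deg (R⊆X u∈R)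
  ... | twoNeighbours {p} {q} p≢q p∈X q∈X u~p u~q with centre p∈X u~p | centre q∈X u~q
    where
    centre : ∀ {w} → w ∈ X → adj G u w ≡ true → w ≡ a ⊎ w ≡ b
    centre {w} w∈X u~w with w ≟ᶠ a | w ≟ᶠ b
    ... | yes w≡a | _       = inj₁ w≡a
    ... | no _    | yes w≡b = inj₂ w≡b
    ... | no w≢a  | no w≢b  =
      contradiction (trans (sym u~w) (isolated (∈R⁺ w∈X (R-neighbour≢v u∈R u~w) w≢a w≢b))) λ ()
  ... | inj₁ refl | inj₁ refl = contradiction refl p≢q
  ... | inj₁ refl | inj₂ refl = u~p , u~q
  ... | inj₂ refl | inj₁ refl = u~q , u~p
  ... | inj₂ refl | inj₂ refl = contradiction refl p≢q

  R-neighbours-in-X′ : ∀ {u} → u ∈ R → TwoNeighbours G X′ u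
  R-neighbours-in-X′ u∈R = two-neighbours-kept (deg (R⊆X u∈R)) λ w∈X u~w → ∈-remove⁺ w∈X (R-neighbour≢v u∈R u~w)

  ih-k-1 : (H : Graph n) (Z : VSet n) → size Z ≡ 2 + m → 0 < m → MinDeg2 H Z → I H Z ≤ maxI (2 + m)
  ih-k-1 H Z ∣Z∣ 0<m deg′ = subst (λ s → I H Z ≤ maxI s) ∣Z∣
    (ih H Z (subst (3 ≤_) (sym ∣Z∣) (+-monoʳ-≤ 2 0<m)) (subst (_< k) (sym ∣Z∣) (≤-reflexive (sym k≡3+m))) deg′)

  0<m : ∀ {u} → u ∈ R → 0 < m
  0<m u∈R = subst (0 <_) (sym (size-remove R u∈R)) (s≤s z≤n)

  2≤m : ∀ {x y} → x ∈ R → y ∈ R → x ≢ y → 2 ≤ m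
  2≤m x∈R y∈R x≢y = subst (2 ≤_) (sym (size-remove₂ R x∈R y∈R x≢y)) (m≤m+n 2 _)

  Edge : Set
  Edge = ∃[ x ] ∃[ y ] x ∈ R × y ∈ R × adj G x y ≡ true

  edge? : Dec Edge
  edge? = any? λ x → any? λ y → x ∈? R ×-dec y ∈? R ×-dec adj G x y ≟ᵇ true

  no-edge⇒stable : ¬ Edge → Stable G R
  no-edge⇒stable no-edge {x} {y} x∈R y∈R with adj G x y in x~y
  ... | true  = contradiction (x , y , x∈R , y∈R , x~y) no-edge
  ... | false = refl

  conclude : ∀ {A B} → I G X ≡ A + B → 2 ≤ m → A ≤ maxI (2 + m) → B ≤ 2 ^ m → (3 ≤ m → B < 2 ^ m) → Outcome G X k
  conclude I≡ 2≤m′ = pendant-conclude m k≡3+m 2≤m′ I≡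

  -- If R is independent, G[X] is K_{2,k-2} with centres a and b; otherwise
  -- adding the edge ab gives a graph on X - v of minimum degree ≥ 2.
  module NonAdjacentCentres (a≁b : adj G a b ≡ false)
    {pa} (pa∈X : pa ∈ X) (a~pa : adj G a pa ≡ true) (pa≢v : pa ≢ v)
    {pb} (pb∈X : pb ∈ X) (b~pb : adj G b pb ≡ true) (pb≢v : pb ≢ v) where

    pa∈R : pa ∈ R
    pa∈R = ∈R⁺ pa∈X pa≢v (adjacent⇒≢ G a~pa ∘′ sym) (neighbour≢non-neighbour G a~pa a≁b ∘′ sym)
    pb∈X′ : pb ∈ X′
    pb∈X′ = ∈-remove⁺ pb∈X pb≢v
    pb≢a : pb ≢ a
    pb≢a = neighbour≢non-neighbour G b~pb (trans (adj-sym G b a) a≁b) ∘′ sym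

    shape : Stable G R → K2Shape G X
    shape stable = record
      { a = a ; b = b ; a∈X = a∈X ; b∈X = b∈X ; a≢b = a≢b ; a≁b = a≁b
      ; ~a = λ x∈X x≢a x≢b → proj₁ (centres x∈X x≢a x≢b)
      ; ~b = λ x∈X x≢a x≢b → proj₂ (centres x∈X x≢a x≢b)
      ; leaves-stable = leaves-stable }
      where
      centres : ∀ {x} → x ∈ X → x ≢ a → x ≢ b → adj G x a ≡ true × adj G x b ≡ true
      centres {x} x∈X x≢a x≢b with x ≟ᶠ v
      ... | yes refl = v~a , v~b
      ... | no x≢v   = to-both-centres x∈R (stable x∈R)
        where x∈R = ∈R⁺ x∈X x≢v x≢a x≢b
      leaf : ∀ {u} → u ∈ X - a - b → u ≡ v ⊎ u ∈ R
      leaf {u} u∈ with ∈-remove⁻ u∈ | u ≟ᶠ v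
      ... | _ , _ | yes u≡v = inj₁ u≡v
      ... | u∈X-a , u≢b | no u≢v = let (u∈X , u≢a) = ∈-remove⁻ u∈X-a in inj₂ (∈R⁺ u∈X u≢v u≢a u≢b)
      leaves-stable : Stable G (X - a - b)
      leaves-stable u∈ w∈ with leaf u∈ | leaf w∈
      ... | inj₁ refl | inj₁ refl = irrefl G v
      ... | inj₁ refl | inj₂ w∈R  = v≁R w∈R
      ... | inj₂ u∈R  | inj₁ refl = trans (adj-sym G _ v) (v≁R u∈R)
      ... | inj₂ u∈R  | inj₂ w∈R  = stable u∈R w∈R

    -- R spans an edge: G + ab on X - v, and the independent sets lost by adding
    -- ab live in C = X - v - N[a] - N[b] ⊆ R.
    via-added-edge : Edge → Outcome G X k
    via-added-edge (x , y , x∈R , y∈R , x~y) =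
      conclude I-X≡ (2≤m x∈R y∈R (adjacent⇒≢ G x~y)) (ih-k-1 G⁺ X′ ∣X′∣ (0<m pa∈R) deg⁺) (proj₁ C+R) (proj₂ C+R)
      where
      G⁺ = addEdge G a b a≢b
      C  = X′ -N[ G ] a -N[ G ] b
      deg⁺ : MinDeg2 G⁺ X′
      deg⁺ {u} u∈X′ with u ≟ᶠ a | u ≟ᶠ b
      ... | yes refl | _        = twoNeighbours (R-≢b pa∈R ∘′ sym)
        b∈X′ (remove-⊆ (remove-⊆ pa∈R)) (addEdge-adds G a≢b) (addEdge-keeps G a≢b a~pa)
      ... | no _     | yes refl = twoNeighbours (pb≢a ∘′ sym)
        a∈X′ pb∈X′ (trans (adj-sym G⁺ b a) (addEdge-adds G a≢b)) (addEdge-keeps G a≢b b~pb)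
      ... | no u≢a   | no u≢b   = let (u∈X , u≢v) = ∈-remove⁻ u∈X′ in
        two-neighbours-super (addEdge-keeps G a≢b) (R-neighbours-in-X′ (∈R⁺ u∈X u≢v u≢a u≢b))
      C⊆R : C ⊆ R
      C⊆R h with ∈-removeN⁻ {G = G} h
      ... | u∈X′-Na , u≢b , b≁u with ∈-removeN⁻ {G = G} u∈X′-Na
      ... | u∈X′ , u≢a , a≁u = let (u∈X , u≢v) = ∈-remove⁻ u∈X′ in ∈R⁺ u∈X u≢v u≢a u≢b
      C-neighbours : ∀ {c} → c ∈ C → TwoNeighbours G R c
      C-neighbours {c} h with ∈-removeN⁻ {G = G} h
      ... | c∈X′-Na , _ , b≁c with ∈-removeN⁻ {G = G} c∈X′-Na
      ... | _ , _ , a≁c = two-neighbours-kept (deg (R⊆X c∈R)) λ w∈X c~w →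
          ∈R⁺ w∈X (R-neighbour≢v c∈R c~w)
              (neighbour≢non-neighbour G c~w (trans (adj-sym G c a) a≁c) ∘′ sym)
              (neighbour≢non-neighbour G c~w (trans (adj-sym G c b) b≁c) ∘′ sym)
        where c∈R = C⊆R h
      pa∉C : pa ∉ C
      pa∉C h = contradiction (trans (sym a~pa) (proj₂ (proj₂ (∈-removeN⁻ {G = G} (proj₁ (∈-removeN⁻ {G = G} h)))))) λ ()
      C+R = CBound.I-C+R G R C C⊆R C-neighbours pa∈R pa∉C x∈R y∈R x~y
      I-X≡ : I G X ≡ I G⁺ X′ + (I G C + I G R)
      I-X≡ = trans I-X (trans (cong (_+ I G R) (I-addEdge G a≢b X′ a∈X′ b∈X′ a≁b)) (+-assoc (I G⁺ X′) (I G C) (I G R)))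

    outcome : Outcome G X k
    outcome with edge?
    ... | yes edge   = via-added-edge edge
    ... | no no-edge = extremal (subst (4 ≤_) (sym k≡3+m) (+-monoʳ-≤ 3 (0<m pa∈R))) (shape (no-edge⇒stable no-edge))

  -- Case a ~ b, where both a and b have a neighbour outside the triangle vab:
  -- then G[X - v] still has minimum degree ≥ 2.
  module BothExtend (a~b : adj G a b ≡ true)
    {pa} (pa∈X : pa ∈ X) (a~pa : adj G a pa ≡ true) (pa≢v : pa ≢ v) (pa≢b : pa ≢ b)
    {pb} (pb∈X : pb ∈ X) (b~pb : adj G b pb ≡ true) (pb≢v : pb ≢ v) (pb≢a : pb ≢ a) where

    pa∈R : pa ∈ R
    pa∈R = ∈R⁺ pa∈X pa≢v (adjacent⇒≢ G a~pa ∘′ sym) pa≢b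

    deg′ : MinDeg2 G X′
    deg′ {u} u∈X′ with u ≟ᶠ a | u ≟ᶠ b
    ... | yes refl | _        = twoNeighbours (pa≢b ∘′ sym) b∈X′ (∈-remove⁺ pa∈X pa≢v) a~b a~pa
    ... | no _     | yes refl = twoNeighbours (pb≢a ∘′ sym) a∈X′ (∈-remove⁺ pb∈X pb≢v) (trans (adj-sym G b a) a~b) b~pb
    ... | no u≢a   | no u≢b   = let (u∈X , u≢v) = ∈-remove⁻ u∈X′ in R-neighbours-in-X′ (∈R⁺ u∈X u≢v u≢a u≢b)

    X′≤ : I G X′ ≤ maxI (2 + m)
    X′≤ = ih-k-1 G X′ ∣X′∣ (0<m pa∈R) deg′

    -- If R is independent, every vertex of R is adjacent to a and b, and
    -- i(G[X]) = (2^m + 1 + 1) + 2^m = maxI (3 + m) - 1.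
    independent-rest : Stable G R → I G X < maxI k
    independent-rest stable = begin-strict
      I G X                                              ≡⟨ I-X ⟩
      I G X′ + I G R                                     ≡⟨ cong (_+ I G R) (I-split G X′ a∈X′) ⟩
      (I G (X′ - a) + I G (X′ -N[ G ] a)) + I G R        ≡⟨ cong (λ t → (t + I G (X′ -N[ G ] a)) + I G R) (I-split G (X′ - a) b∈X′-a) ⟩
      ((I G R + I G (X′ - a -N[ G ] b)) + I G (X′ -N[ G ] a)) + I G R
        ≡⟨ cong₂ (λ s t → ((I G R + s) + t) + I G R) (I-empty G _ not-b) (I-empty G _ not-a) ⟩
      ((I G R + 1) + 1) + I G R                          ≡⟨ cong (λ t → ((t + 1) + 1) + t) (I-stable G R stable) ⟩
      ((2 ^ m + 1) + 1) + 2 ^ m                          <⟨ maxI-triangle-< m (0<m pa∈R) ⟩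
      maxI (3 + m)                                       ≡⟨ cong maxI k≡3+m ⟨
      maxI k ∎
      where
      open ≤-Reasoning
      b∈X′-a : b ∈ X′ - a
      b∈X′-a = ∈-remove⁺ b∈X′ (a≢b ∘′ sym)
      both : ∀ {u} → u ∈ R → adj G u a ≡ true × adj G u b ≡ true
      both u∈R = to-both-centres u∈R (stable u∈R)
      not-b : ∀ u → u ∉ X′ - a -N[ G ] b
      not-b u h with ∈-removeN⁻ {G = G} h
      ... | u∈X′-a , u≢b , b≁u with ∈-remove⁻ u∈X′-a
      ... | u∈X′ , u≢a = let (u∈X , u≢v) = ∈-remove⁻ u∈X′ in
        contradiction (trans (sym (proj₂ (both (∈R⁺ u∈X u≢v u≢a u≢b)))) (trans (adj-sym G u b) b≁u)) λ ()
      not-a : ∀ u → u ∉ X′ -N[ G ] a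
      not-a u h with ∈-removeN⁻ {G = G} h | u ≟ᶠ b
      ... | _ , _ , a≁u | yes refl = contradiction (trans (sym a~b) a≁u) λ ()
      ... | u∈X′ , u≢a , a≁u | no u≢b = let (u∈X , u≢v) = ∈-remove⁻ u∈X′ in
        contradiction (trans (sym (proj₁ (both (∈R⁺ u∈X u≢v u≢a u≢b)))) (trans (adj-sym G u a) a≁u)) λ ()

    outcome : Outcome G X k
    outcome with edge?
    ... | yes (x , y , x∈R , y∈R , x~y) =
      conclude I-X (2≤m x∈R y∈R (adjacent⇒≢ G x~y)) X′≤ (<⇒≤ R<) (λ _ → R<)
      where R< = I-edge-< G R x∈R y∈R x~y
    ... | no no-edge = below (independent-rest (no-edge⇒stable no-edge))

  -- Case a ~ b where v and b are the only neighbours of a in X.  Then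
  -- X - v - N[a] = R, and with RB = X - v - a - N[b]:
  --   i(G[X]) = ((i(R) + i(RB)) + i(R)) + i(R).
  module ClosedCentre (a~b : adj G a b ≡ true) (only-v-b : ∀ w → w ∈ X → adj G a w ≡ true → w ≡ v ⊎ w ≡ b) where

    a≁R : ∀ {u} → u ∈ R → adj G a u ≡ false
    a≁R {u} u∈R with adj G a u in a~u
    ... | false = refl
    ... | true with only-v-b u (R⊆X u∈R) a~u
    ...   | inj₁ u≡v = contradiction u≡v (R-≢v u∈R)
    ...   | inj₂ u≡b = contradiction u≡b (R-≢b u∈R)

    R-neighbour≢a : ∀ {u w} → u ∈ R → adj G u w ≡ true → w ≢ a
    R-neighbour≢a {u} u∈R u~w refl = contradiction (trans (sym u~w) (trans (adj-sym G u a) (a≁R u∈R))) λ ()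

    RB = X′ - a -N[ G ] b

    b∈X′-a : b ∈ X′ - a
    b∈X′-a = ∈-remove⁺ b∈X′ (a≢b ∘′ sym)

    I-X≡ : I G X ≡ ((I G R + I G RB) + I G R) + I G R
    I-X≡ = trans I-X (cong (_+ I G R) (trans (I-split G X′ a∈X′)
      (cong₂ _+_ (I-split G (X′ - a) b∈X′-a) (I-cong G X′-Na⊆R R⊆X′-Na))))
      where
      X′-Na⊆R : X′ -N[ G ] a ⊆ R
      X′-Na⊆R h with ∈-removeN⁻ {G = G} h
      ... | u∈X′ , u≢a , a≁u = ∈-remove⁺ (∈-remove⁺ u∈X′ u≢a) (neighbour≢non-neighbour G a~b a≁u)
      R⊆X′-Na : R ⊆ X′ -N[ G ] a
      R⊆X′-Na u∈R = let (u∈X , u≢v , u≢a , _) = ∈R⁻ u∈R in ∈-removeN⁺ {G = G} (∈-remove⁺ u∈X u≢v) u≢a (a≁R u∈R)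

    -- b has no neighbour in R: G[X] is a triangle beside G[R], i(G[X]) = 4 · i(G[R]).
    module IsolatedTriangle (b≁R : ∀ {u} → u ∈ R → adj G b u ≡ false) where

      I-X≡4R : I G X ≡ 4 * I G R
      I-X≡4R = trans I-X≡ (trans (cong (λ t → ((I G R + t) + I G R) + I G R) (I-cong G RB⊆R R⊆RB)) (four (I G R)))
        where
        RB⊆R : RB ⊆ R
        RB⊆R h = let (u∈X′-a , u≢b , _) = ∈-removeN⁻ {G = G} h in ∈-remove⁺ u∈X′-a u≢b
        R⊆RB : R ⊆ RB
        R⊆RB u∈R = let (u∈X′-a , u≢b) = ∈-remove⁻ u∈R in ∈-removeN⁺ {G = G} u∈X′-a u≢b (b≁R u∈R)
        four : ∀ x → ((x + x) + x) + x ≡ 4 * x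
        four = solve-∀

      -- the neighbours of a vertex of R lie in R
      deg-R : MinDeg2 G R
      deg-R u∈R = two-neighbours-kept (deg (R⊆X u∈R)) λ w∈X u~w →
        ∈R⁺ w∈X (R-neighbour≢v u∈R u~w) (R-neighbour≢a u∈R u~w)
            (neighbour≢non-neighbour G u~w (trans (adj-sym G _ b) (b≁R u∈R)) ∘′ sym)

      outcome : Outcome G X k
      outcome with m ≟ 0
      ... | yes m≡0 = exceptional (inj₁ (trans k≡3+m (cong (3 +_) m≡0))) (begin
        I G X       ≡⟨ I-X≡4R ⟩
        4 * I G R   ≡⟨ cong (4 *_) (I-empty G R λ u u∈R → contradiction (0<m u∈R) (λ 0<m → <-irrefl (sym m≡0) 0<m)) ⟩
        4           ≡⟨ cong maxI (trans k≡3+m (cong (3 +_) m≡0)) ⟨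
        maxI k ∎)
        where open ≤-Reasoning
      ... | no m≢0 with nonempty-member R (n≢0⇒n>0 m≢0)
      ... | u , u∈R = below (begin-strict
        I G X         ≡⟨ I-X≡4R ⟩
        4 * I G R     ≤⟨ *-monoʳ-≤ 4 (ih G R 3≤m (subst (m <_) (sym k≡3+m) (m<n+m m (s≤s z≤n))) deg-R) ⟩
        4 * maxI m    <⟨ maxI-four-copies m 3≤m ⟩
        maxI (3 + m)  ≡⟨ cong maxI k≡3+m ⟨
        maxI k ∎)
        where
        open ≤-Reasoning
        3≤m = three≤size u∈R (deg-R u∈R)

    -- b has a neighbour d ∈ R: replace a by the edge vd.  In G* = G + vd the set
    -- X* = X - a has minimum degree ≥ 2, i(G*[X*]) = (i(R) + i(RB)) + i(R - d),
    -- and the remaining i(R) + i(R - N[d]) is bounded by NeighbourhoodBound.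
    module ThroughR {d} (d∈R : d ∈ R) (b~d : adj G b d ≡ true) where

      d∈X = R⊆X d∈R
      v≢d : v ≢ d
      v≢d = R-≢v d∈R ∘′ sym
      b≢d : b ≢ d
      b≢d = R-≢b d∈R ∘′ sym

      G* = addEdge G v d v≢d
      X* = X - a

      v∈X* : v ∈ X*
      v∈X* = ∈-remove⁺ v∈X v≢a
      b∈X* : b ∈ X*
      b∈X* = ∈-remove⁺ b∈X (a≢b ∘′ sym)
      d∈X* : d ∈ X*
      d∈X* = ∈-remove⁺ d∈X (R-≢a d∈R)

      ∣X*∣ : size X* ≡ 2 + m
      ∣X*∣ = suc-injective (trans (sym (size-remove X a∈X)) (trans ∣X∣ k≡3+m))

      deg* : MinDeg2 G* X*
      deg* {u} u∈X* with ∈-remove⁻ u∈X* | u ≟ᶠ v | u ≟ᶠ b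
      ... | _ | yes refl | _ = twoNeighbours b≢d b∈X* d∈X* (addEdge-keeps G v≢d v~b) (addEdge-adds G v≢d)
      ... | _ | no _ | yes refl =
        twoNeighbours v≢d v∈X* d∈X* (addEdge-keeps G v≢d (trans (adj-sym G b v) v~b)) (addEdge-keeps G v≢d b~d)
      ... | u∈X , u≢a | no u≢v | no u≢b = two-neighbours-super (addEdge-keeps G v≢d)
        (two-neighbours-kept (deg u∈X) λ w∈X u~w → ∈-remove⁺ w∈X (R-neighbour≢a u∈R u~w))
        where u∈R = ∈R⁺ u∈X u≢v u≢a u≢b

      X*≤ : I G* X* ≤ maxI (2 + m)
      X*≤ = ih-k-1 G* X* ∣X*∣ (0<m d∈R) deg*

      I-X* : I G* X* ≡ (I G R + I G RB) + I G (R - d)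
      I-X* = begin
        I G* X*                                ≡⟨ I-split G* X* v∈X* ⟩
        I G* (X* - v) + I G* (X* -N[ G* ] v)   ≡⟨ cong₂ _+_ (I-addEdge-away G v≢d (proj₂ ∘′ ∈-remove⁻))
                                                           (I-addEdge-away G v≢d (λ h → proj₁ (proj₂ (∈-removeN⁻ {G = G*} h)))) ⟩
        I G (X* - v) + I G (X* -N[ G* ] v)     ≡⟨ cong₂ _+_ (I-cong G X*-v⊆X′-a X′-a⊆X*-v) (I-cong G N*⊆R-d R-d⊆N*) ⟩
        I G (X′ - a) + I G (R - d)             ≡⟨ cong (_+ I G (R - d)) (I-split G (X′ - a) b∈X′-a) ⟩
        (I G R + I G RB) + I G (R - d) ∎
        where
        open ≡-Reasoning
        X*-v⊆X′-a : X* - v ⊆ X′ - a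
        X*-v⊆X′-a h = let (u∈X* , u≢v) = ∈-remove⁻ h ; (u∈X , u≢a) = ∈-remove⁻ u∈X* in ∈-remove⁺ (∈-remove⁺ u∈X u≢v) u≢a
        X′-a⊆X*-v : X′ - a ⊆ X* - v
        X′-a⊆X*-v h = let (u∈X′ , u≢a) = ∈-remove⁻ h ; (u∈X , u≢v) = ∈-remove⁻ u∈X′ in ∈-remove⁺ (∈-remove⁺ u∈X u≢a) u≢v
        N*⊆R-d : X* -N[ G* ] v ⊆ R - d
        N*⊆R-d h with ∈-removeN⁻ {G = G*} h
        ... | u∈X* , u≢v , v≁*u = let (u∈X , u≢a) = ∈-remove⁻ u∈X* ; v≁u = addEdge-non-edge G v≢d v≁*u in
          ∈-remove⁺ (∈R⁺ u∈X u≢v u≢a (neighbour≢non-neighbour G v~b v≁u))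
                    (neighbour≢non-neighbour G* (addEdge-adds G v≢d) v≁*u)
        R-d⊆N* : R - d ⊆ X* -N[ G* ] v
        R-d⊆N* h = let (u∈R , u≢d) = ∈-remove⁻ h ; (u∈X , u≢v , u≢a , _) = ∈R⁻ u∈R in
          ∈-removeN⁺ {G = G*} (∈-remove⁺ u∈X u≢a) u≢v
            (trans (addEdge-elsewhere G v≢d (λ (_ , u≡d) → u≢d u≡d) (λ (v≡d , _) → v≢d v≡d)) (v≁R u∈R))

      I-X≡* : I G X ≡ I G* X* + (I G R + I G (R -N[ G ] d))
      I-X≡* = begin
        I G X                                                       ≡⟨ I-X≡ ⟩
        ((I G R + I G RB) + I G R) + I G R                          ≡⟨ cong (((I G R + I G RB) + I G R) +_) (I-split G R d∈R) ⟩
        ((I G R + I G RB) + I G R) + (I G (R - d) + I G (R -N[ G ] d))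
          ≡⟨ regroup (I G R) (I G RB) (I G (R - d)) (I G (R -N[ G ] d)) ⟩
        ((I G R + I G RB) + I G (R - d)) + (I G R + I G (R -N[ G ] d)) ≡⟨ cong (_+ (I G R + I G (R -N[ G ] d))) I-X* ⟨
        I G* X* + (I G R + I G (R -N[ G ] d)) ∎
        where
        open ≡-Reasoning
        regroup : ∀ A B P Q → ((A + B) + A) + (P + Q) ≡ ((A + B) + P) + (A + Q)
        regroup = solve-∀

      R-neighbour : ∀ {z} → z ∈ R → ∃[ w ] w ∈ R × adj G z w ≡ true
      R-neighbour z∈R with another-neighbour (deg (R⊆X z∈R)) b
      ... | w , w∈X , z~w , w≢b = w , ∈R⁺ w∈X (R-neighbour≢v z∈R z~w) (R-neighbour≢a z∈R z~w) w≢b , z~w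

      outcome : Outcome G X k
      outcome with R-neighbour d∈R
      ... | e , e∈R , d~e = conclude I-X≡* (2≤m d∈R e∈R (adjacent⇒≢ G d~e)) X*≤
        (NeighbourhoodBound.I-with-N-≤ G R d∈R e∈R d~e R-neighbour)
        (NeighbourhoodBound.I-with-N-< G R d∈R e∈R d~e R-neighbour)

    outcome : Outcome G X k
    outcome with any? (λ u → u ∈? R ×-dec adj G b u ≟ᵇ true)
    ... | yes (d , d∈R , b~d) = ThroughR.outcome d∈R b~d
    ... | no none = IsolatedTriangle.outcome b≁R
      where
      b≁R : ∀ {u} → u ∈ R → adj G b u ≡ false
      b≁R {u} u∈R with adj G b u in b~u
      ... | true  = contradiction (u , u∈R , b~u) none
      ... | false = refl

pendant-outcome : ∀ {n k} → BoundBelow n k → (G : Graph n) (X : VSet n) → size X ≡ k → MinDeg2 G X →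
  ∀ {v a b} → ExactlyTwo G X v a b → Outcome G X k
pendant-outcome {k = k} ih G X ∣X∣ deg {v} {a} {b} (v∈X , a≢b , a∈X , b∈X , v~a , v~b , only-a-b) = by-cases
  where
  module P  = Pendant ih G X ∣X∣ deg v∈X a≢b a∈X b∈X v~a v~b only-a-b
  module P′ = Pendant ih G X ∣X∣ deg v∈X (a≢b ∘′ sym) b∈X a∈X v~b v~a (λ w w∈X v~w → Sum.swap (only-a-b w w∈X v~w))
  by-cases : Outcome G X k
  by-cases with adj G a b in a~b? | third-or-only G X a v b | third-or-only G X b v a
  ... | true | inj₁ (pa , pa∈X , a~pa , pa≢v , pa≢b) | inj₁ (pb , pb∈X , b~pb , pb≢v , pb≢a) =
    P.BothExtend.outcome a~b? pa∈X a~pa pa≢v pa≢b pb∈X b~pb pb≢v pb≢a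
  ... | true | inj₂ a-closed | _ = P.ClosedCentre.outcome a~b? a-closed
  ... | true | inj₁ _ | inj₂ b-closed = P′.ClosedCentre.outcome (trans (adj-sym G b a) a~b?) b-closed
  ... | false | _ | _ with another-neighbour (deg a∈X) v | another-neighbour (deg b∈X) v
  ...   | pa , pa∈X , a~pa , pa≢v | pb , pb∈X , b~pb , pb≢v =
    P.NonAdjacentCentres.outcome a~b? pa∈X a~pa pa≢v pb∈X b~pb pb≢v

outcome : ∀ {n} (G : Graph n) (X : VSet n) → 3 ≤ size X → MinDeg2 G X → Outcome G X (size X)
outcome {n} G X 3≤∣X∣ deg = <-rec Claim step (size X) G X refl 3≤∣X∣ deg
  where
  Claim : ℕ → Set
  Claim k = ∀ (G : Graph n) (X : VSet n) → size X ≡ k → 3 ≤ k → MinDeg2 G X → Outcome G X k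
  hypothesis : ∀ {k} → (∀ {j} → j < k → Claim j) → BoundBelow n k
  hypothesis smaller G X 3≤∣X∣ ∣X∣<k deg = outcome-bound (smaller ∣X∣<k G X refl 3≤∣X∣ deg)
  step : ∀ k → (∀ {j} → j < k → Claim j) → Claim k
  step k smaller G X ∣X∣ 3≤k deg with degree-two-or-three deg
  ... | inj₁ (v , a , b , two) = pendant-outcome (hypothesis smaller) G X ∣X∣ deg two
  ... | inj₂ three             = below (all-degree-three (hypothesis smaller) G X ∣X∣ 3≤k three)

small-other : ∀ {n} (x : Fin (2 + n)) → x ≢ zero → x ≢ suc zero → small x ≡ false
small-other zero          x≢0 _   = contradiction refl x≢0
small-other (suc zero)    _   x≢1 = contradiction refl x≢1
small-other (suc (suc _)) _   _   = refl

K2-shape : ∀ j → K2Shape (K2 (2 + j)) full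
K2-shape j = record
  { a = zero ; b = suc zero ; a∈X = mem refl ; b∈X = mem refl ; a≢b = λ () ; a≁b = refl
  ; ~a = λ {x} _ x≢a x≢b → cong (_xor true) (small-other x x≢a x≢b)
  ; ~b = λ {x} _ x≢a x≢b → cong (_xor true) (small-other x x≢a x≢b)
  ; leaves-stable = λ {u} {w} u∈ w∈ → cong₂ _xor_ (leaf u∈) (leaf w∈) }
  where
  leaf : ∀ {u} → u ∈ full - zero - suc zero → small u ≡ false
  leaf {u} h = let (u∈ , u≢1) = ∈-remove⁻ h ; (_ , u≢0) = ∈-remove⁻ u∈ in small-other u u≢0 u≢1

module CentresToFront {m} {a b : Fin (2 + m)} (a≢b : a ≢ b) where

  private
    transpose-here : ∀ {n} (i j : Fin n) → PC.transpose i j i ≡ j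
    transpose-here i j rewrite dec-true (i ≟ᶠ i) refl = refl

    transpose-there : ∀ {n} (i j : Fin n) → PC.transpose i j j ≡ i
    transpose-there i j with j ≟ᶠ i
    ... | yes j≡i = j≡i
    ... | no _ rewrite dec-true (j ≟ᶠ j) refl = refl

    transpose-other : ∀ {n} {i j k : Fin n} → k ≢ i → k ≢ j → PC.transpose i j k ≡ k
    transpose-other {i = i} {j} {k} k≢i k≢j rewrite dec-false (k ≟ᶠ i) k≢i | dec-false (k ≟ᶠ j) k≢j = refl

    b′ = PC.transpose a zero b

  π : Perm.Permutation′ (2 + m)
  π = Perm.transpose a zero Perm.∘ₚ Perm.transpose b′ (suc zero)

  f : Fin (2 + m) → Fin (2 + m)
  f = π Perm.⟨$⟩ʳ_

  f-bijective : Bijective _≡_ _≡_ f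
  f-bijective = Bijection.bijective (↔⇒⤖ π)

  f-injective : ∀ {x y} → f x ≡ f y → x ≡ y
  f-injective = proj₁ f-bijective

  f-a : f a ≡ zero
  f-a = trans (cong (PC.transpose b′ (suc zero)) (transpose-here a zero)) (transpose-other b′≢0 λ ())
    where
    b′≢0 : zero ≢ b′
    b′≢0 0≡b′ = a≢b (trans (sym (PC.transpose-inverse zero a)) (trans (cong (PC.transpose zero a) (trans (transpose-here a zero) 0≡b′)) (PC.transpose-inverse zero a)))

  f-b : f b ≡ suc zero
  f-b = transpose-here b′ (suc zero)

  f-other : ∀ {x} → x ≢ a → x ≢ b → small (f x) ≡ false
  f-other x≢a x≢b = small-other _ (λ fx≡0 → x≢a (f-injective (trans fx≡0 (sym f-a))))
                                  (λ fx≡1 → x≢b (f-injective (trans fx≡1 (sym f-b))))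

private
  centre-or-leaf : ∀ {n} {a b : Fin n} x → x ≡ a ⊎ x ≡ b ⊎ (x ≢ a × x ≢ b)
  centre-or-leaf {a = a} {b} x with x ≟ᶠ a | x ≟ᶠ b
  ... | yes x≡a | _       = inj₁ x≡a
  ... | no _    | yes x≡b = inj₂ (inj₁ x≡b)
  ... | no x≢a  | no x≢b  = inj₂ (inj₂ (x≢a , x≢b))

K2Shape⇒≅ : ∀ {m} (G : Graph (2 + m)) → K2Shape G full → G ≅ K2 (2 + m)
K2Shape⇒≅ G shape = f , f-bijective , preserves
  where
  open K2Shape shape
  open CentresToFront a≢b
  small-a : small (f a) ≡ true
  small-a = cong small f-a
  small-b : small (f b) ≡ true
  small-b = cong small f-b
  preserves : ∀ u w → adj G u w ≡ small (f u) xor small (f w)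
  preserves u w with centre-or-leaf {a = a} {b} u | centre-or-leaf {a = a} {b} w
  ... | inj₁ refl | inj₁ refl = trans (irrefl G a) (sym (cong₂ _xor_ small-a small-a))
  ... | inj₁ refl | inj₂ (inj₁ refl) = trans a≁b (sym (cong₂ _xor_ small-a small-b))
  ... | inj₁ refl | inj₂ (inj₂ (w≢a , w≢b)) =
    trans (trans (adj-sym G a w) (~a (mem refl) w≢a w≢b)) (sym (cong₂ _xor_ small-a (f-other w≢a w≢b)))
  ... | inj₂ (inj₁ refl) | inj₁ refl = trans (trans (adj-sym G b a) a≁b) (sym (cong₂ _xor_ small-b small-a))
  ... | inj₂ (inj₁ refl) | inj₂ (inj₁ refl) = trans (irrefl G b) (sym (cong₂ _xor_ small-b small-b))
  ... | inj₂ (inj₁ refl) | inj₂ (inj₂ (w≢a , w≢b)) =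
    trans (trans (adj-sym G b w) (~b (mem refl) w≢a w≢b)) (sym (cong₂ _xor_ small-b (f-other w≢a w≢b)))
  ... | inj₂ (inj₂ (u≢a , u≢b)) | inj₁ refl =
    trans (~a (mem refl) u≢a u≢b) (sym (cong₂ _xor_ (f-other u≢a u≢b) small-a))
  ... | inj₂ (inj₂ (u≢a , u≢b)) | inj₂ (inj₁ refl) =
    trans (~b (mem refl) u≢a u≢b) (sym (cong₂ _xor_ (f-other u≢a u≢b) small-b))
  ... | inj₂ (inj₂ (u≢a , u≢b)) | inj₂ (inj₂ (w≢a , w≢b)) =
    trans (leaves-stable (∈-remove⁺ (∈-remove⁺ (mem refl) u≢a) u≢b) (∈-remove⁺ (∈-remove⁺ (mem refl) w≢a) w≢b))
          (sym (cong₂ _xor_ (f-other u≢a u≢b) (f-other w≢a w≢b)))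

-- Conversely, a graph isomorphic to K2 (2 + m) has the K_{2,m} shape: its centres
-- are the preimages of 0 and 1.
≅⇒K2Shape : ∀ {m} (G : Graph (2 + m)) → G ≅ K2 (2 + m) → K2Shape G full
≅⇒K2Shape G (f , (f-injective , f-surjective) , preserves) = record
  { a = a ; b = b ; a∈X = mem refl ; b∈X = mem refl
  ; a≢b = λ a≡b → 0≢1 (trans (sym f-a) (trans (cong f a≡b) f-b))
  ; a≁b = trans (preserves a b) (cong₂ (λ s t → small s xor small t) f-a f-b)
  ; ~a = λ {x} _ x≢a x≢b → trans (preserves x a) (cong₂ (λ s t → s xor small t) (other x≢a x≢b) f-a)
  ; ~b = λ {x} _ x≢a x≢b → trans (preserves x b) (cong₂ (λ s t → s xor small t) (other x≢a x≢b) f-b)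
  ; leaves-stable = λ {u} {w} u∈ w∈ →
      let (u∈′ , u≢b) = ∈-remove⁻ u∈ ; (_ , u≢a) = ∈-remove⁻ u∈′ ; (w∈′ , w≢b) = ∈-remove⁻ w∈ ; (_ , w≢a) = ∈-remove⁻ w∈′ in
      trans (preserves u w) (cong₂ _xor_ (other u≢a u≢b) (other w≢a w≢b)) }
  where
  0≢1 : zero ≢ suc zero
  0≢1 ()
  a = proj₁ (f-surjective zero)
  f-a : f a ≡ zero
  f-a = proj₂ (f-surjective zero) refl
  b = proj₁ (f-surjective (suc zero))
  f-b : f b ≡ suc zero
  f-b = proj₂ (f-surjective (suc zero)) refl
  other : ∀ {x} → x ≢ a → x ≢ b → small (f x) ≡ false
  other x≢a x≢b = small-other _ (λ fx≡0 → x≢a (f-injective (trans fx≡0 (sym f-a))))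
                                (λ fx≡1 → x≢b (f-injective (trans fx≡1 (sym f-b))))

i-K2 : ∀ j → i (K2 (2 + j)) ≡ 2 ^ j + 3
i-K2 j = trans (i≡I-full (K2 (2 + j))) (I-K2Shape (K2 (2 + j)) full j (size-full (2 + j)) (K2-shape j))

MinDegree⇒MinDeg2 : ∀ {n} (G : Graph n) → (∀ v → 2 ≤ degree G v) → MinDeg2 G full
MinDegree⇒MinDeg2 G 2≤deg {x} _ with two-members (N G x) (subst (2 ≤_) (degree≡size-N G x) (2≤deg x))
... | p , q , p≢q , mem x~p , mem x~q = twoNeighbours p≢q (mem refl) (mem refl) x~p x~q

-- The corollary: run the induction on the whole vertex set.  For n ≠ 5 equality
-- rules out the strict and exceptional outcomes, leaving the K_{2,n-2} shape.
corollary1p5 : (n : ℕ) → 4 ≤ n → (G : Graph n) → MinDegree G 2 →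
    (i G ≤ i (K2 n))
    × ((n ≡ 4 ⊎ 6 ≤ n) → (i G ≡ i (K2 n) ⇔ G ≅ K2 n))
corollary1p5 0 ()
corollary1p5 1 (s≤s ())
corollary1p5 2 (s≤s (s≤s ()))
corollary1p5 3 (s≤s (s≤s (s≤s ())))
corollary1p5 n@(suc (suc (suc (suc j)))) _ G (2≤deg , _) = bound , λ n≢5 → mk⇔ (extremal-only n≢5) K2-count
  where
  result : Outcome G full (size (full {n}))
  result = outcome G full (subst (3 ≤_) (sym (size-full n)) (s≤s (s≤s (s≤s z≤n)))) (MinDegree⇒MinDeg2 G 2≤deg)
  i-G : i G ≡ I G full
  i-G = i≡I-full G
  bound : i G ≤ i (K2 n)
  bound = subst₂ _≤_ (sym i-G) (trans (cong maxI (size-full n)) (sym (i-K2 (2 + j)))) (outcome-bound {X = full} result)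
  not-five : ¬ (5 ≡ 4 ⊎ 6 ≤ 5)
  not-five (inj₂ (s≤s (s≤s (s≤s (s≤s (s≤s ()))))))
  extremal-only : n ≡ 4 ⊎ 6 ≤ n → i G ≡ i (K2 n) → G ≅ K2 n
  extremal-only n≢5 i≡ with subst (Outcome G full) (size-full n) result
  ... | below I<                 = contradiction (trans (sym i-G) (trans i≡ (i-K2 (2 + j)))) (<⇒≢ I<)
  ... | exceptional (inj₂ refl) _ = contradiction n≢5 not-five
  ... | extremal _ shape         = K2Shape⇒≅ G shape
  K2-count : G ≅ K2 n → i G ≡ i (K2 n)
  K2-count iso = trans i-G (trans (I-K2Shape G full (2 + j) (size-full n) (≅⇒K2Shape G iso)) (sym (i-K2 (2 + j))))
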